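{- Let $R>1$ be an integer all of whose prime factors $p$ satisfy $p\equiv 1\pmod 4$, and let $\tau(R)$ denote the number of positive divisors of $R$. Then there exists an integral point set over $\mathbb{Z}^2$ consisting of $2\tau(R)$ points lying on a circle of radius $R$ together with the center of this circle.
   Context: An integral point set over $\mathbb{Z}^2$ is a finite set of points of $\mathbb{Z}^2$, not all on one line, such that the Euclidean distance between any two of its points is an integer. -}

module Defs where

open import Data.Nat as ℕ using (ℕ; suc)
open import Data.Nat.Divisibility using (_∣?_)
open import Data.Integer as ℤ using (ℤ; +_; _-_; _*_; _+_)
open import Data.Product using (_×_; _,_; ∃; ∃-syntax)
open import Data.List using (List; length; filter; map; upTo)
open import Data.List.Membership.Propositional using (_∈_)
open import Data.List.Relation.Unary.All using (All)
open import Data.List.Relation.Unary.Unique.Propositional using (Unique)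
open import Relation.Binary.PropositionalEquality using (_≡_; _≢_)

Point : Set
Point = ℤ × ℤ

dist² : Point → Point → ℤ
dist² (x₁ , y₁) (x₂ , y₂) = (x₁ - x₂) * (x₁ - x₂) + (y₁ - y₂) * (y₁ - y₂)

HasIntegerDistance : Point → Point → Set
HasIntegerDistance P Q = ∃[ d ] dist² P Q ≡ (+ d) * (+ d)

Collinear : Point → Point → Point → Set
Collinear (x₁ , y₁) (x₂ , y₂) (x₃ , y₃) =
  (x₂ - x₁) * (y₃ - y₁) - (y₂ - y₁) * (x₃ - x₁) ≡ + 0

NotAllCollinear : List Point → Set
NotAllCollinear L = ∃[ P ] ∃[ Q ] ∃[ S ] (P ∈ L × Q ∈ L × S ∈ L × (Collinear P Q S → Data.Empty.⊥))
  where import Data.Empty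

IntegralPointSet : List Point → Set
IntegralPointSet L =
  Unique L × NotAllCollinear L ×
  (∀ {P Q} → P ∈ L → Q ∈ L → HasIntegerDistance P Q)

τ : ℕ → ℕ
τ n = length (filter (_∣? n) (map suc (upTo n)))

module Submission where

-- View ℤ² as the Gaussian integers.  Write
-- R = q₁ ⋯ qₙ and split each qᵢ = πᵢ π̄ᵢ (Fermat's two-square theorem, proved
-- à la Zagier).  A divisor d of R selects A_d = ∏ (πᵢ if qᵢ goes into d, else
-- π̄ᵢ), of norm R; the points are ±A_d².  For N(A) = N(B) = R the distances
-- |A² ∓ B²| = 2|Im or Re (A B̄)| are integers, and so is the distance R to 0.
-- The points are distinct because d can be read off A_d²: the gcd of the
-- coordinates of A_d² (π₁ ⋯ πₙ)² is (R/d)², the cofactor ∏_{qᵢ ∣ d} πᵢ⁴ being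
-- primitive.

module InvolutionParity where

  open import Data.Nat using (ℕ; suc; _+_; _*_; _≤_; s≤s)
  open import Data.Nat.Properties using (≤-refl; ≤-trans; n≤1+n; +-suc; *-suc)
  open import Data.List using (List; []; _∷_; length; filter)
  open import Data.List.Properties using (length-removeAt′)
  open import Data.List.Membership.Propositional using (_∈_)
  open import Data.List.Relation.Unary.Any using (here; there; index; _─_)
  open import Data.List.Relation.Unary.All.Properties using (─⁺; All¬⇒¬Any)
  open import Data.List.Relation.Unary.Unique.Propositional using (Unique; _∷_)
  open import Data.Product using (∃; _,_; _×_; proj₁; proj₂)
  open import Data.Empty using (⊥-elim)
  open import Relation.Binary.PropositionalEquality
  open import Relation.Binary.Definitions using (DecidableEquality)
  open import Relation.Nullary using (Dec; yes; no)

  module _ {A : Set} where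

    ─-⊆ : ∀ {y z : A} xs (p : y ∈ xs) → z ∈ (xs ─ p) → z ∈ xs
    ─-⊆ (x ∷ xs) (here _) z∈ = there z∈
    ─-⊆ (x ∷ xs) (there p) (here z≡x) = here z≡x
    ─-⊆ (x ∷ xs) (there p) (there z∈) = there (─-⊆ xs p z∈)

    ─-keeps : ∀ {y z : A} xs (p : y ∈ xs) → z ∈ xs → z ≢ y → z ∈ (xs ─ p)
    ─-keeps (x ∷ xs) (here refl) (here refl) z≢y = ⊥-elim (z≢y refl)
    ─-keeps (x ∷ xs) (here _) (there z∈) _ = z∈
    ─-keeps (x ∷ xs) (there p) (here z≡x) _ = here z≡x
    ─-keeps (x ∷ xs) (there p) (there z∈) z≢y = there (─-keeps xs p z∈ z≢y)

    ─-removes : ∀ {y z : A} xs (p : y ∈ xs) → Unique xs → z ∈ (xs ─ p) → z ≢ y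
    ─-removes (x ∷ xs) (here refl) (x∉ ∷ _) z∈ refl = All¬⇒¬Any x∉ z∈
    ─-removes (x ∷ xs) (there p) (x∉ ∷ _) (here refl) refl = All¬⇒¬Any x∉ p
    ─-removes (x ∷ xs) (there p) (_ ∷ u) (there z∈) = ─-removes xs p u z∈

    ─-unique : ∀ {y : A} xs (p : y ∈ xs) → Unique xs → Unique (xs ─ p)
    ─-unique (x ∷ xs) (here _) (_ ∷ u) = u
    ─-unique (x ∷ xs) (there p) (x∉ ∷ u) = ─⁺ p x∉ ∷ ─-unique xs p u

  -- Parity principle: an involution f of a finite duplicate-free set L has as
  -- many fixed points as L has elements, modulo 2 (non-fixed points pair up
  -- as {x , f x}).
  module Involution {A : Set} (_≟_ : DecidableEquality A) (f : A → A) where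

    isFixed? : (x : A) → Dec (f x ≡ x)
    isFixed? x = f x ≟ x

    fixedPoints : List A → ℕ
    fixedPoints L = length (filter isFixed? L)

    ClosedUnder : List A → Set
    ClosedUnder L = ∀ {x} → x ∈ L → f x ∈ L

    InvolutiveOn : List A → Set
    InvolutiveOn L = ∀ {x} → x ∈ L → f (f x) ≡ x

    fixedPoints-─ : ∀ {y} xs (p : y ∈ xs) → f y ≢ y → fixedPoints (xs ─ p) ≡ fixedPoints xs
    fixedPoints-─ (x ∷ xs) (here refl) fx≢x with isFixed? x
    ... | yes fx≡x = ⊥-elim (fx≢x fx≡x)
    ... | no _ = refl
    fixedPoints-─ (x ∷ xs) (there p) fy≢y with isFixed? x
    ... | yes _ = cong suc (fixedPoints-─ xs p fy≢y)
    ... | no _ = fixedPoints-─ xs p fy≢y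

    -- Dropping a fixed head x keeps the rest closed under f: f y = x would
    -- give y = f (f y) = f x = x.
    closed-dropFixed : ∀ {x xs} → Unique (x ∷ xs) → ClosedUnder (x ∷ xs) → InvolutiveOn (x ∷ xs) →
                       f x ≡ x → ClosedUnder xs
    closed-dropFixed {x} {xs} (x∉xs ∷ _) closed invol fx≡x {y} y∈xs with closed (there y∈xs)
    ... | there fy∈xs = fy∈xs
    ... | here fy≡x = ⊥-elim (All¬⇒¬Any x∉xs (subst (_∈ xs) y≡x y∈xs))
      where
      y≡x : y ≡ x
      y≡x = trans (sym (invol (there y∈xs))) (trans (cong f fy≡x) fx≡x)

    closed-dropPair : ∀ {x xs} → Unique (x ∷ xs) → ClosedUnder (x ∷ xs) → InvolutiveOn (x ∷ xs) →
                      (fx∈xs : f x ∈ xs) → ClosedUnder (xs ─ fx∈xs)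
    closed-dropPair {x} {xs} (x∉xs ∷ u) closed invol fx∈xs {y} y∈rest with closed (there (─-⊆ xs fx∈xs y∈rest))
    ... | here fy≡x = ⊥-elim (─-removes xs fx∈xs u y∈rest
                       (trans (sym (invol (there (─-⊆ xs fx∈xs y∈rest)))) (cong f fy≡x)))
    ... | there fy∈xs = ─-keeps xs fx∈xs fy∈xs fy≢fx
      where
      fy≢fx : f y ≢ f x
      fy≢fx fy≡fx = All¬⇒¬Any x∉xs (subst (_∈ xs) y≡x (─-⊆ xs fx∈xs y∈rest))
        where
        y≡x : y ≡ x
        y≡x = trans (sym (invol (there (─-⊆ xs fx∈xs y∈rest)))) (trans (cong f fy≡fx) (invol (here refl)))

    -- Induction on a bound n for the length: a fixed head is dropped, a
    -- non-fixed head x is dropped together with its partner f x.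
    parity-bounded : ∀ n L → length L ≤ n → Unique L → ClosedUnder L → InvolutiveOn L →
                     ∃ λ k → length L ≡ fixedPoints L + 2 * k
    parity-bounded n [] _ _ _ _ = 0 , refl
    parity-bounded (suc n) (x ∷ xs) (s≤s len≤n) uniq@(_ ∷ u) closed invol with isFixed? x
    ... | yes fx≡x =
      let (k , eq) = parity-bounded n xs len≤n u (closed-dropFixed uniq closed invol fx≡x) (λ y∈ → invol (there y∈))
      in k , cong suc eq
    ... | no fx≢x with closed (here refl)
    ...   | here fx≡x = ⊥-elim (fx≢x fx≡x)
    ...   | there fx∈xs = suc k , counted
      where
      rest = xs ─ fx∈xs
      length-rest : length xs ≡ suc (length rest)
      length-rest = length-removeAt′ xs (index fx∈xs)
      IH = parity-bounded n rest (≤-trans (n≤1+n _) (subst (_≤ n) length-rest len≤n)) (─-unique xs fx∈xs u)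
             (closed-dropPair uniq closed invol fx∈xs) (λ y∈rest → invol (there (─-⊆ xs fx∈xs y∈rest)))
      k = proj₁ IH
      counted : suc (length xs) ≡ fixedPoints xs + 2 * suc k
      counted = begin
        suc (length xs)                       ≡⟨ cong suc length-rest ⟩
        suc (suc (length rest))               ≡⟨ cong (λ t → suc (suc t)) (proj₂ IH) ⟩
        suc (suc (fixedPoints rest + 2 * k))  ≡⟨ cong (λ t → suc (suc (t + 2 * k))) fixedRest ⟩
        suc (suc (fixedPoints xs + 2 * k))    ≡⟨ sym (shift (fixedPoints xs) k) ⟩
        fixedPoints xs + 2 * suc k            ∎
        where
        open ≡-Reasoning
        fixedRest : fixedPoints rest ≡ fixedPoints xs
        fixedRest = fixedPoints-─ xs fx∈xs (λ ffx≡fx → fx≢x (trans (sym ffx≡fx) (invol (here refl))))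
        shift : ∀ m k → m + 2 * suc k ≡ suc (suc (m + 2 * k))
        shift m k rewrite *-suc 2 k | +-suc m (suc (2 * k)) | +-suc m (2 * k) = refl

    parity : ∀ L → Unique L → ClosedUnder L → InvolutiveOn L →
             ∃ λ k → length L ≡ fixedPoints L + 2 * k
    parity L = parity-bounded (length L) L ≤-refl

    fixedPoint-exists : ∀ L → fixedPoints L ≢ 0 → ∃ λ x → x ∈ L × (f x ≡ x)
    fixedPoint-exists [] none = ⊥-elim (none refl)
    fixedPoint-exists (x ∷ xs) some with isFixed? x
    ... | yes fx≡x = x , here refl , fx≡x
    ... | no _ = let (y , y∈xs , fy≡y) = fixedPoint-exists xs some in y , there y∈xs , fy≡y

module TwoSquares where

  open import Data.Nat
  open import Data.Nat.Properties
  open import Data.Nat.Tactic.RingSolver using (solve-∀)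
  open import Data.Nat.Primality using (Prime; prime⇒irreducible; prime⇒nonTrivial)
  open import Data.Nat.Divisibility using (divides)
  open import Data.Nat.DivMod using (_/_; m≡m%n+[m/n]*n)
  open import Data.Product using (∃; _,_; _×_; proj₁; proj₂)
  open import Data.Product.Properties using (≡-dec)
  open import Data.Sum using (inj₁; inj₂)
  open import Data.Empty using (⊥-elim)
  open import Data.List using (List; []; _∷_; length; filter; map; upTo; cartesianProduct)
  open import Data.List.Membership.Propositional using (_∈_)
  open import Data.List.Membership.Propositional.Properties
    using (∈-map⁺; ∈-map⁻; ∈-upTo⁺; ∈-cartesianProduct⁺; ∈-cartesianProduct⁻; ∈-filter⁺; ∈-filter⁻)
  open import Data.List.Relation.Unary.All using (All; _∷_; tabulate)
  open import Data.List.Relation.Unary.Unique.Propositional using (Unique; _∷_)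
  import Data.List.Relation.Unary.Unique.Propositional.Properties as Unique
  open import Relation.Binary.PropositionalEquality
  open import Relation.Nullary using (Dec; yes; no; ¬_)
  open InvolutionParity

  -- The solutions (x, y, z) ∈ ℕ₊³ of x² + 4yz = p form a finite set on which
  -- the Zagier map ζ is an involution with exactly one fixed point, so the set
  -- has odd size; hence the involution (x, y, z) ↦ (x, z, y) has a fixed point,
  -- which gives p = x² + (2y)².

  Triple : Set
  Triple = ℕ × ℕ × ℕ

  windmill : Triple → ℕ
  windmill (x , y , z) = x * x + 4 * (y * z)

  ζ : Triple → Triple
  ζ (x , y , z) with x + z <? y
  ... | yes _ = (x + 2 * z , z , y ∸ (x + z))
  ... | no _ with 2 * y <? x
  ...   | yes _ = (x ∸ 2 * y , (x + z) ∸ y , y)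
  ...   | no _ = (2 * y ∸ x , y , (x + z) ∸ y)

  ζ-region₁ : ∀ x y z → x + z < y → ζ (x , y , z) ≡ (x + 2 * z , z , y ∸ (x + z))
  ζ-region₁ x y z r₁ with x + z <? y
  ... | yes _ = refl
  ... | no ¬r₁ = ⊥-elim (¬r₁ r₁)

  ζ-region₂ : ∀ x y z → ¬ (x + z < y) → ¬ (2 * y < x) → ζ (x , y , z) ≡ (2 * y ∸ x , y , (x + z) ∸ y)
  ζ-region₂ x y z ¬r₁ ¬r₃ with x + z <? y
  ... | yes r₁ = ⊥-elim (¬r₁ r₁)
  ... | no _ with 2 * y <? x
  ...   | yes r₃ = ⊥-elim (¬r₃ r₃)
  ...   | no _ = refl

  ζ-region₃ : ∀ x y z → ¬ (x + z < y) → 2 * y < x → ζ (x , y , z) ≡ (x ∸ 2 * y , (x + z) ∸ y , y)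
  ζ-region₃ x y z ¬r₁ r₃ with x + z <? y
  ... | yes r₁ = ⊥-elim (¬r₁ r₁)
  ... | no _ with 2 * y <? x
  ...   | yes _ = refl
  ...   | no ¬r₃ = ⊥-elim (¬r₃ r₃)

  ≤-from-+ : ∀ {a b} c → a + c ≡ b → a ≤ b
  ≤-from-+ {a} c a+c≡b = subst (a ≤_) a+c≡b (m≤m+n a c)

  ∸-from-+ : ∀ {a b} c → a + c ≡ b → b ∸ a ≡ c
  ∸-from-+ {a} c refl = m+n∸m≡n a c

  region₂-sum : ∀ x y z U V → x + U ≡ 2 * y → y + V ≡ x + z → U + V ≡ y + z
  region₂-sum x y z U V x+U≡2y y+V≡x+z = +-cancelˡ-≡ (x + y) _ _ (begin
    (x + y) + (U + V) ≡⟨ regroup x y U V ⟩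
    (x + U) + (y + V) ≡⟨ cong₂ _+_ x+U≡2y y+V≡x+z ⟩
    2 * y + (x + z)   ≡⟨ regroup′ x y z ⟩
    (x + y) + (y + z) ∎)
    where
    open ≡-Reasoning
    regroup : ∀ x y U V → (x + y) + (U + V) ≡ (x + U) + (y + V)
    regroup = solve-∀
    regroup′ : ∀ x y z → 2 * y + (x + z) ≡ (x + y) + (y + z)
    regroup′ = solve-∀

  -- both windmill values plus xU equal (x + U)(x + 2z) = (x + U)(U + 2V)
  region₂-windmill : ∀ x y z U V → x + U ≡ 2 * y → y + V ≡ x + z → windmill (U , y , V) ≡ windmill (x , y , z)
  region₂-windmill x y z U V x+U≡2y y+V≡x+z = +-cancelʳ-≡ (x * U) _ _ (begin
    (U * U + 4 * (y * V)) + x * U     ≡⟨ expand₁ U y V x ⟩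
    U * U + 2 * V * (2 * y) + x * U   ≡⟨ cong (λ t → U * U + 2 * V * t + x * U) (sym x+U≡2y) ⟩
    U * U + 2 * V * (x + U) + x * U   ≡⟨ expand₂ U V x ⟩
    (x + U) * (U + 2 * V)             ≡⟨ cong ((x + U) *_) U+2V≡x+2z ⟩
    (x + U) * (x + 2 * z)             ≡⟨ expand₃ x U z ⟩
    x * x + 2 * z * (x + U) + x * U   ≡⟨ cong (λ t → x * x + 2 * z * t + x * U) x+U≡2y ⟩
    x * x + 2 * z * (2 * y) + x * U   ≡⟨ expand₄ x z y U ⟩
    (x * x + 4 * (y * z)) + x * U     ∎)
    where
    open ≡-Reasoning
    U+2V≡x+2z : U + 2 * V ≡ x + 2 * z
    U+2V≡x+2z = +-cancelˡ-≡ x _ _ (begin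
      x + (U + 2 * V) ≡⟨ regroup x U V ⟩
      (x + U) + 2 * V ≡⟨ cong (_+ 2 * V) x+U≡2y ⟩
      2 * y + 2 * V   ≡⟨ sym (*-distribˡ-+ 2 y V) ⟩
      2 * (y + V)     ≡⟨ cong (2 *_) y+V≡x+z ⟩
      2 * (x + z)     ≡⟨ regroup′ x z ⟩
      x + (x + 2 * z) ∎)
      where
      regroup : ∀ x U V → x + (U + 2 * V) ≡ (x + U) + 2 * V
      regroup = solve-∀
      regroup′ : ∀ x z → 2 * (x + z) ≡ x + (x + 2 * z)
      regroup′ = solve-∀
    expand₁ : ∀ U y V x → (U * U + 4 * (y * V)) + x * U ≡ U * U + 2 * V * (2 * y) + x * U
    expand₁ = solve-∀
    expand₂ : ∀ U V x → U * U + 2 * V * (x + U) + x * U ≡ (x + U) * (U + 2 * V)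
    expand₂ = solve-∀
    expand₃ : ∀ x U z → (x + U) * (x + 2 * z) ≡ x * x + 2 * z * (x + U) + x * U
    expand₃ = solve-∀
    expand₄ : ∀ x z y U → x * x + 2 * z * (2 * y) + x * U ≡ (x * x + 4 * (y * z)) + x * U
    expand₄ = solve-∀

  prime⇒notSquare : ∀ {p} → Prime p → ∀ m → m * m ≢ p
  prime⇒notSquare {p} p-prime = notSquare (nonTrivial⇒n>1 p {{prime⇒nonTrivial p-prime}})
    where
    notSquare : 1 < p → ∀ m → m * m ≢ p
    notSquare 1<p m m²≡p with prime⇒irreducible p-prime (divides m (sym m²≡p))
    ... | inj₁ refl = <⇒≢ 1<p m²≡p
    ... | inj₂ refl = <⇒≢ 1<p (sym (*-cancelʳ-≡ m 1 m {{>-nonZero (<-trans z<s 1<p)}}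
                                     (trans m²≡p (sym (*-identityˡ m)))))

  module Zagier (p k : ℕ) (p≡4k+1 : p ≡ suc (4 * k)) (p-prime : Prime p) where

    Solution : Triple → Set
    Solution (x , y , z) = windmill (x , y , z) ≡ p × 1 ≤ x × 1 ≤ y × 1 ≤ z

    1<p : 1 < p
    1<p = nonTrivial⇒n>1 p {{prime⇒nonTrivial p-prime}}

    p-notEven : ∀ n → 2 * n ≢ p
    p-notEven n 2n≡p = even≢odd n (2 * k) (trans 2n≡p (trans p≡4k+1 (cong suc (*-assoc 2 2 k))))

    -- x² + 4xz = x (x + 4z) is prime only for x = 1
    fixed⇒x≡1 : ∀ x z → x * x + 4 * (x * z) ≡ p → x ≡ 1
    fixed⇒x≡1 x z eq with prime⇒irreducible p-prime (divides (x + 4 * z) (sym (trans (factor x z) eq)))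
      where
      factor : ∀ x z → (x + 4 * z) * x ≡ x * x + 4 * (x * z)
      factor = solve-∀
    ... | inj₁ x≡1 = x≡1
    ... | inj₂ refl = ⊥-elim (≤⇒≯ (≤-from-+ (4 * (p * z)) eq) (m<m*n p p {{>-nonZero (<-trans z<s 1<p)}} 1<p))

    ZagierStep : Triple → Set
    ZagierStep t@(x , y , z) = Solution (ζ t) × ζ (ζ t) ≡ t × (ζ t ≡ t → x ≡ 1 × y ≡ 1)

    -- Region 1 (y = x + z + 1 + w) is sent to region 3 and back.
    step₁ : ∀ x z w → Solution (x , suc (x + z) + w , z) → ZagierStep (x , suc (x + z) + w , z)
    step₁ x@(suc x′) z@(suc _) w (eq , _)
      rewrite ζ-region₁ x (suc (x + z) + w) z (≤-from-+ w refl) | ∸-from-+ {x + z} (suc w) (+-suc (x + z) w) =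
        (trans (image x z w) eq , s≤s z≤n , s≤s z≤n , s≤s z≤n) , back , λ fixed → ⊥-elim (moved fixed)
      where
      image : ∀ x z w → (x + 2 * z) * (x + 2 * z) + 4 * (z * suc w) ≡ x * x + 4 * ((suc (x + z) + w) * z)
      image = solve-∀
      ¬r₁ : ¬ ((x + 2 * z) + suc w < z)
      ¬r₁ = ≤⇒≯ (≤-from-+ (x + z + suc w) (rearrange x z w))
        where
        rearrange : ∀ x z w → z + (x + z + suc w) ≡ (x + 2 * z) + suc w
        rearrange = solve-∀
      r₃ : 2 * z < x + 2 * z
      r₃ = ≤-from-+ x′ (rearrange x′ z)
        where
        rearrange : ∀ x′ z → suc (2 * z) + x′ ≡ suc x′ + 2 * z
        rearrange = solve-∀
      back : ζ (x + 2 * z , z , suc w) ≡ (x , suc (x + z) + w , z)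
      back rewrite ζ-region₃ (x + 2 * z) z (suc w) ¬r₁ r₃ =
        cong₂ _,_ (m+n∸n≡m x (2 * z)) (cong (_, z) (∸-from-+ {z} (suc (x + z) + w) (rearrange x z w)))
        where
        rearrange : ∀ x z w → z + (suc (x + z) + w) ≡ (x + 2 * z) + suc w
        rearrange = solve-∀
      moved : (x + 2 * z , z , suc w) ≢ (x , suc (x + z) + w , z)
      moved same = m+1+n≢m x (cong proj₁ same)

    -- (2y + 1 + u) + z − y written as a successor
    region₃-shift : ∀ y u z → y + suc (y + u + z) ≡ suc (2 * y) + u + z
    region₃-shift = solve-∀

    -- Region 3 (x = 2y + 1 + u) is sent to region 1 and back.
    step₃ : ∀ y z u → ¬ (suc (2 * y) + u + z < y) →
            Solution (suc (2 * y) + u , y , z) → ZagierStep (suc (2 * y) + u , y , z)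
    step₃ y@(suc _) z@(suc z′) u ¬r₁ (eq , _)
      rewrite ζ-region₃ (suc (2 * y) + u) y z ¬r₁ (≤-from-+ u refl)
            | ∸-from-+ {2 * y} (suc u) (+-suc (2 * y) u)
            | ∸-from-+ {y} (suc (y + u + z)) (region₃-shift y u z) =
        (trans (image y z u) eq , s≤s z≤n , s≤s z≤n , s≤s z≤n) , back , λ fixed → ⊥-elim (moved fixed)
      where
      image : ∀ y z u → suc u * suc u + 4 * (suc (y + u + z) * y) ≡ (suc (2 * y) + u) * (suc (2 * y) + u) + 4 * (y * z)
      image = solve-∀
      r₁ : suc u + y < suc (y + u + z)
      r₁ = ≤-from-+ z′ (rearrange y u z′)
        where
        rearrange : ∀ y u z′ → suc (suc u + y) + z′ ≡ suc (y + u + suc z′)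
        rearrange = solve-∀
      back : ζ (suc u , suc (y + u + z) , y) ≡ (suc (2 * y) + u , y , z)
      back rewrite ζ-region₁ (suc u) (suc (y + u + z)) y r₁ =
        cong₂ _,_ (rearrange₃ y u) (cong (y ,_) (∸-from-+ {suc u + y} z (rearrange₄ y u z)))
        where
        rearrange₃ : ∀ y u → suc u + 2 * y ≡ suc (2 * y) + u
        rearrange₃ = solve-∀
        rearrange₄ : ∀ y u z → (suc u + y) + z ≡ suc (y + u + z)
        rearrange₄ = solve-∀
      moved : (suc u , suc (y + u + z) , y) ≢ (suc (2 * y) + u , y , z)
      moved same = m+1+n≢m u (trans (+-comm u (2 * y)) (sym (suc-injective (cong proj₁ same))))

    -- Region 2 (x + U = 2y and y + V = x + z, with U, V ≥ 1) is mapped to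
    -- itself by (x, y, z) ↦ (U, y, V); it is fixed only when x = y = 1.
    step₂ : ∀ x y z u v → ¬ (x + z < y) → ¬ (2 * y < x) → x + suc u ≡ 2 * y → y + suc v ≡ x + z →
            Solution (x , y , z) → ZagierStep (x , y , z)
    step₂ x y z u v ¬r₁ ¬r₃ x+U≡2y y+V≡x+z (eq , _ , 1≤y , _)
      rewrite ζ-region₂ x y z ¬r₁ ¬r₃
            | ∸-from-+ {x} (suc u) x+U≡2y
            | ∸-from-+ {y} (suc v) y+V≡x+z =
        (trans (region₂-windmill x y z U V x+U≡2y y+V≡x+z) eq , s≤s z≤n , 1≤y , s≤s z≤n) , back , fixed⇒
      where
      U = suc u
      V = suc v
      U+V≡y+z : U + V ≡ y + z
      U+V≡y+z = region₂-sum x y z U V x+U≡2y y+V≡x+z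
      back : ζ (U , y , V) ≡ (x , y , z)
      back rewrite ζ-region₂ U y V (≤⇒≯ (≤-from-+ z (sym U+V≡y+z))) (≤⇒≯ (≤-from-+ x (trans (+-comm U x) x+U≡2y))) =
        cong₂ _,_ (trans (cong (_∸ U) (sym x+U≡2y)) (m+n∸n≡m x U))
                  (cong (y ,_) (trans (cong (_∸ y) U+V≡y+z) (m+n∸m≡n y z)))
      fixed⇒ : (U , y , V) ≡ (x , y , z) → x ≡ 1 × y ≡ 1
      fixed⇒ same = x≡1 , trans (sym x≡y) x≡1
        where
        x≡y : x ≡ y
        x≡y = *-cancelˡ-≡ x y 2 (trans (cong (x +_) (trans (+-identityʳ x) (sym (cong proj₁ same)))) x+U≡2y)
        x≡1 : x ≡ 1
        x≡1 = fixed⇒x≡1 x z (trans (cong (λ t → x * x + 4 * (t * z)) x≡y) eq)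

    -- On the boundaries y = x + z and x = 2y there are no solutions, because p
    -- is neither a square nor even.
    boundary₁ : ∀ x y z → windmill (x , y , z) ≡ p → y ≢ x + z
    boundary₁ x y z eq refl = prime⇒notSquare p-prime (x + 2 * z) (trans (square x z) eq)
      where
      square : ∀ x z → (x + 2 * z) * (x + 2 * z) ≡ x * x + 4 * ((x + z) * z)
      square = solve-∀

    boundary₃ : ∀ x y z → windmill (x , y , z) ≡ p → x ≢ 2 * y
    boundary₃ x y z eq refl = p-notEven (2 * (y * y) + 2 * (y * z)) (trans (double y z) eq)
      where
      double : ∀ y z → 2 * (2 * (y * y) + 2 * (y * z)) ≡ 2 * y * (2 * y) + 4 * (y * z)
      double = solve-∀

    byRegion : ∀ x y z → Solution (x , y , z) → Dec (x + z < y) → Dec (2 * y < x) → ZagierStep (x , y , z)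
    byRegion x y z sol (yes r₁) _ with m≤n⇒∃[o]m+o≡n r₁
    ... | w , refl = step₁ x z w sol
    byRegion x y z sol (no ¬r₁) (yes r₃) with m≤n⇒∃[o]m+o≡n r₃
    ... | u , refl = step₃ y z u ¬r₁ sol
    byRegion x y z sol@(eq , _) (no ¬r₁) (no ¬r₃)
      with m≤n⇒∃[o]m+o≡n (≤∧≢⇒< (≮⇒≥ ¬r₃) (boundary₃ x y z eq))
         | m≤n⇒∃[o]m+o≡n (≤∧≢⇒< (≮⇒≥ ¬r₁) (boundary₁ x y z eq))
    ... | u , 1+x+u≡2y | v , 1+y+v≡x+z =
      step₂ x y z u v ¬r₁ ¬r₃ (trans (+-suc x u) 1+x+u≡2y) (trans (+-suc y v) 1+y+v≡x+z) sol

    zagierStep : ∀ t → Solution t → ZagierStep t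
    zagierStep (x , y , z) sol = byRegion x y z sol (x + z <? y) (2 * y <? x)

    -- All coordinates of a solution lie in 1 … p, so the solutions are the
    -- members of an explicit finite list.
    range : List ℕ
    range = map suc (upTo p)

    ∈-range⁺ : ∀ {c} → 1 ≤ c → c ≤ p → c ∈ range
    ∈-range⁺ {suc c} _ c<p = ∈-map⁺ suc (∈-upTo⁺ c<p)

    ∈-range⁻ : ∀ {c} → c ∈ range → 1 ≤ c
    ∈-range⁻ c∈ with ∈-map⁻ suc c∈
    ... | _ , _ , refl = s≤s z≤n

    onWindmill? : (t : Triple) → Dec (windmill t ≡ p)
    onWindmill? t = windmill t ≟ p

    solutions : List Triple
    solutions = filter onWindmill? (cartesianProduct range (cartesianProduct range range))

    solutions-unique : Unique solutions
    solutions-unique = Unique.filter⁺ onWindmill?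
      (Unique.cartesianProduct⁺ range-unique (Unique.cartesianProduct⁺ range-unique range-unique))
      where
      range-unique : Unique range
      range-unique = Unique.map⁺ suc-injective (Unique.upTo⁺ p)

    ∈-solutions⁺ : ∀ {t} → Solution t → t ∈ solutions
    ∈-solutions⁺ {x , y , z} (eq , 1≤x , 1≤y , 1≤z) =
      ∈-filter⁺ onWindmill?
        (∈-cartesianProduct⁺ (∈-range⁺ 1≤x x≤p) (∈-cartesianProduct⁺ (∈-range⁺ 1≤y y≤p) (∈-range⁺ 1≤z z≤p))) eq
      where
      x≤p : x ≤ p
      x≤p = ≤-trans (m≤m*n x x {{>-nonZero 1≤x}}) (≤-from-+ (4 * (y * z)) eq)
      yz≤p : y * z ≤ p
      yz≤p = ≤-trans (m≤n*m (y * z) 4) (≤-from-+ (x * x) (trans (+-comm _ (x * x)) eq))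
      y≤p : y ≤ p
      y≤p = ≤-trans (m≤m*n y z {{>-nonZero 1≤z}}) yz≤p
      z≤p : z ≤ p
      z≤p = ≤-trans (m≤n*m z y {{>-nonZero 1≤y}}) yz≤p

    ∈-solutions⁻ : ∀ {t} → t ∈ solutions → Solution t
    ∈-solutions⁻ {x , y , z} t∈ with ∈-filter⁻ onWindmill? t∈
    ... | t∈box , eq with ∈-cartesianProduct⁻ range _ t∈box
    ...   | x∈ , yz∈ with ∈-cartesianProduct⁻ range range yz∈
    ...     | y∈ , z∈ = eq , ∈-range⁻ x∈ , ∈-range⁻ y∈ , ∈-range⁻ z∈

    _≟T_ : (s t : Triple) → Dec (s ≡ t)
    _≟T_ = ≡-dec _≟_ (≡-dec _≟_ _≟_)

    swapYZ : Triple → Triple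
    swapYZ (x , y , z) = x , z , y

    module ζ-Involution = Involution _≟T_ ζ
    module swap-Involution = Involution _≟T_ swapYZ

    -- (1, 1, k) is the unique fixed point of ζ among the solutions.
    ζ-oneFixedPoint : ζ-Involution.fixedPoints solutions ≡ 1
    ζ-oneFixedPoint = singleton (Unique.filter⁺ ζ-Involution.isFixed? solutions-unique)
                                (tabulate onlyCentre) centre∈
      where
      centreValue : ∀ k → 1 * 1 + 4 * (1 * k) ≡ suc (4 * k)
      centreValue = solve-∀
      1≤k : 1 ≤ k
      1≤k = positive k (subst (1 <_) p≡4k+1 1<p)
        where
        positive : ∀ k → 1 < suc (4 * k) → 1 ≤ k
        positive zero (s≤s ())
        positive (suc _) _ = s≤s z≤n
      centre∈ : (1 , 1 , k) ∈ filter ζ-Involution.isFixed? solutions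
      centre∈ = ∈-filter⁺ ζ-Involution.isFixed?
        (∈-solutions⁺ (trans (centreValue k) (sym p≡4k+1) , s≤s z≤n , s≤s z≤n , 1≤k)) refl
      onlyCentre : ∀ {t} → t ∈ filter ζ-Involution.isFixed? solutions → t ≡ (1 , 1 , k)
      onlyCentre {x , y , z} t∈ with ∈-filter⁻ ζ-Involution.isFixed? t∈
      ... | t∈sol , fixed with ∈-solutions⁻ t∈sol
      ...   | sol@(eq , _) with proj₂ (proj₂ (zagierStep (x , y , z) sol)) fixed
      ...     | refl , refl = cong (λ z → 1 , 1 , z)
                  (*-cancelˡ-≡ z k 4 (suc-injective (trans (trans (sym (centreValue z)) eq) p≡4k+1)))
      singleton : ∀ {v : Triple} {L} → Unique L → All (_≡ v) L → v ∈ L → length L ≡ 1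
      singleton {L = _ ∷ []} _ _ _ = refl
      singleton {L = _ ∷ _ ∷ _} ((a≢b ∷ _) ∷ _) (a≡v ∷ b≡v ∷ _) _ = ⊥-elim (a≢b (trans a≡v (sym b≡v)))

    -- Both maps are involutions of the solution set, so their fixed-point counts
    -- have the parity of the number of solutions; hence swapYZ has a fixed point.
    swap-hasFixedPoint : swap-Involution.fixedPoints solutions ≢ 0
    swap-hasFixedPoint none = even≢odd (proj₁ bySwap) (proj₁ byζ) (begin
      2 * proj₁ bySwap                                           ≡⟨ cong (_+ 2 * proj₁ bySwap) (sym none) ⟩
      swap-Involution.fixedPoints solutions + 2 * proj₁ bySwap   ≡⟨ sym (proj₂ bySwap) ⟩
      length solutions                                           ≡⟨ proj₂ byζ ⟩
      ζ-Involution.fixedPoints solutions + 2 * proj₁ byζ         ≡⟨ cong (_+ 2 * proj₁ byζ) ζ-oneFixedPoint ⟩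
      suc (2 * proj₁ byζ)                                        ∎)
      where
      open ≡-Reasoning
      byζ = ζ-Involution.parity solutions solutions-unique
              (λ t∈ → ∈-solutions⁺ (proj₁ (zagierStep _ (∈-solutions⁻ t∈))))
              (λ t∈ → proj₁ (proj₂ (zagierStep _ (∈-solutions⁻ t∈))))
      bySwap = swap-Involution.parity solutions solutions-unique
                 (λ t∈ → ∈-solutions⁺ (swapSolution (∈-solutions⁻ t∈))) (λ _ → refl)
        where
        swapSolution : ∀ {t} → Solution t → Solution (swapYZ t)
        swapSolution {x , y , z} (eq , 1≤x , 1≤y , 1≤z) =
          trans (cong (λ t → x * x + 4 * t) (*-comm z y)) eq , 1≤x , 1≤z , 1≤y

    sumOfTwoSquares : ∃ λ a → ∃ λ b → a * a + b * b ≡ p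
    sumOfTwoSquares with swap-Involution.fixedPoint-exists solutions swap-hasFixedPoint
    ... | (x , y , .y) , t∈ , refl = x , 2 * y , trans (square x y) (proj₁ (∈-solutions⁻ t∈))
      where
      square : ∀ x y → x * x + 2 * y * (2 * y) ≡ x * x + 4 * (y * y)
      square = solve-∀

  fermatTwoSquares : ∀ p → Prime p → p % 4 ≡ 1 → ∃ λ a → ∃ λ b → a * a + b * b ≡ p
  fermatTwoSquares p p-prime p%4≡1 = Zagier.sumOfTwoSquares p (p / 4) p≡4k+1 p-prime
    where
    p≡4k+1 : p ≡ suc (4 * (p / 4))
    p≡4k+1 = trans (m≡m%n+[m/n]*n p 4) (trans (cong (_+ (p / 4) * 4) p%4≡1) (cong suc (*-comm (p / 4) 4)))

module GaussianIntegers where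

  open import Data.Integer using (ℤ; +_; _+_; _*_; -_; _-_)
  open import Data.Integer.Tactic.RingSolver using (solve-∀)
  import Data.Integer.Properties as ℤ
  open import Data.Product using (_×_; _,_)
  open import Relation.Binary.PropositionalEquality

  -- The Gaussian integers ℤ[i], represented by pairs (a , b) = a + bi; the
  -- points of ℤ² are exactly these numbers.

  Gaussian : Set
  Gaussian = ℤ × ℤ

  infixl 7 _·_
  _·_ : Gaussian → Gaussian → Gaussian
  (a , b) · (c , d) = (a * c - b * d , a * d + b * c)

  one : Gaussian
  one = (+ 1 , + 0)

  conj : Gaussian → Gaussian
  conj (a , b) = (a , - b)

  neg : Gaussian → Gaussian
  neg (a , b) = (- a , - b)

  scale : ℤ → Gaussian → Gaussian
  scale k (a , b) = (k * a , k * b)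

  norm : Gaussian → ℤ
  norm (a , b) = a * a + b * b

  ·-comm : ∀ X Y → X · Y ≡ Y · X
  ·-comm (a , b) (c , d) = cong₂ _,_ (re a b c d) (im a b c d)
    where
    re : ∀ a b c d → a * c - b * d ≡ c * a - d * b
    re = solve-∀
    im : ∀ a b c d → a * d + b * c ≡ c * b + d * a
    im = solve-∀

  ·-assoc : ∀ X Y Z → (X · Y) · Z ≡ X · (Y · Z)
  ·-assoc (a , b) (c , d) (e , f) = cong₂ _,_ (re a b c d e f) (im a b c d e f)
    where
    re : ∀ a b c d e f → (a * c - b * d) * e - (a * d + b * c) * f ≡ a * (c * e - d * f) - b * (c * f + d * e)
    re = solve-∀
    im : ∀ a b c d e f → (a * c - b * d) * f + (a * d + b * c) * e ≡ a * (c * f + d * e) + b * (c * e - d * f)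
    im = solve-∀

  ·-interchange : ∀ X Y Z W → (X · Y) · (Z · W) ≡ (X · Z) · (Y · W)
  ·-interchange X Y Z W = begin
    (X · Y) · (Z · W) ≡⟨ ·-assoc X Y (Z · W) ⟩
    X · (Y · (Z · W)) ≡⟨ cong (X ·_) (sym (·-assoc Y Z W)) ⟩
    X · ((Y · Z) · W) ≡⟨ cong (λ T → X · (T · W)) (·-comm Y Z) ⟩
    X · ((Z · Y) · W) ≡⟨ cong (X ·_) (·-assoc Z Y W) ⟩
    X · (Z · (Y · W)) ≡⟨ sym (·-assoc X Z (Y · W)) ⟩
    (X · Z) · (Y · W) ∎
    where open ≡-Reasoning

  norm-· : ∀ X Y → norm (X · Y) ≡ norm X * norm Y
  norm-· (a , b) (c , d) = identity a b c d
    where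
    identity : ∀ a b c d → (a * c - b * d) * (a * c - b * d) + (a * d + b * c) * (a * d + b * c)
                           ≡ (a * a + b * b) * (c * c + d * d)
    identity = solve-∀

  norm-conj : ∀ X → norm (conj X) ≡ norm X
  norm-conj (a , b) = identity a b
    where
    identity : ∀ a b → a * a + (- b) * (- b) ≡ a * a + b * b
    identity = solve-∀

  norm-neg : ∀ X → norm (neg X) ≡ norm X
  norm-neg (a , b) = identity a b
    where
    identity : ∀ a b → (- a) * (- a) + (- b) * (- b) ≡ a * a + b * b
    identity = solve-∀

  conj-·-self : ∀ X → conj X · X ≡ scale (norm X) one
  conj-·-self (a , b) = cong₂ _,_ (re a b) (im a b)
    where
    re : ∀ a b → a * a - (- b) * b ≡ (a * a + b * b) * (+ 1)
    re = solve-∀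
    im : ∀ a b → a * b + (- b) * a ≡ (a * a + b * b) * (+ 0)
    im = solve-∀

  neg-· : ∀ X Y → neg X · Y ≡ neg (X · Y)
  neg-· (a , b) (c , d) = cong₂ _,_ (re a b c d) (im a b c d)
    where
    re : ∀ a b c d → (- a) * c - (- b) * d ≡ - (a * c - b * d)
    re = solve-∀
    im : ∀ a b c d → (- a) * d + (- b) * c ≡ - (a * d + b * c)
    im = solve-∀

  neg-involutive : ∀ X → neg (neg X) ≡ X
  neg-involutive (x , y) = cong₂ _,_ (ℤ.neg-involutive x) (ℤ.neg-involutive y)

  scale-· : ∀ k X Y → scale k X · Y ≡ scale k (X · Y)
  scale-· k (a , b) (c , d) = cong₂ _,_ (re k a b c d) (im k a b c d)
    where
    re : ∀ k a b c d → (k * a) * c - (k * b) * d ≡ k * (a * c - b * d)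
    re = solve-∀
    im : ∀ k a b c d → (k * a) * d + (k * b) * c ≡ k * (a * d + b * c)
    im = solve-∀

  ·-scale : ∀ k X Y → X · scale k Y ≡ scale k (X · Y)
  ·-scale k X Y = trans (·-comm X (scale k Y)) (trans (scale-· k Y X) (cong (scale k) (·-comm Y X)))

  scale-scale : ∀ k l X → scale k (scale l X) ≡ scale (k * l) X
  scale-scale k l (a , b) = cong₂ _,_ (sym (ℤ.*-assoc k l a)) (sym (ℤ.*-assoc k l b))

  scale-one-· : ∀ k X → scale k one · X ≡ scale k X
  scale-one-· k X = trans (scale-· k one X) (cong (scale k) (one-· X))
    where
    one-· : ∀ X → one · X ≡ X
    one-· (a , b) = cong₂ _,_ (re a b) (im a b)
      where
      re : ∀ a b → (+ 1) * a - (+ 0) * b ≡ a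
      re = solve-∀
      im : ∀ a b → (+ 1) * b + (+ 0) * a ≡ b
      im = solve-∀

  scale-·-scale : ∀ k l X Y → scale k X · scale l Y ≡ scale (k * l) (X · Y)
  scale-·-scale k l X Y = trans (scale-· k X (scale l Y)) (trans (cong (scale k) (·-scale l X Y)) (scale-scale k l (X · Y)))

module ConjugateDivisor where

  open import Data.Integer using (ℤ; +_; _+_; _*_; -_; _-_; ∣_∣; NonZero)
  open import Data.Integer.Tactic.RingSolver using (solve-∀)
  import Data.Integer.Properties as ℤ
  open import Data.Integer.Divisibility.Signed as ℤ∣ using (divides) renaming (_∣_ to _∣ℤ_)
  open import Data.Nat as ℕ using (ℕ; suc; zero)
  import Data.Nat.Properties as ℕ
  open import Data.Nat.Divisibility as ℕ∣ using () renaming (_∣_ to _∣ℕ_)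
  open import Data.Nat.Primality using (Prime; euclidsLemma; prime⇒irreducible; prime⇒nonTrivial)
  open import Data.Product using (_,_)
  open import Data.Sum using (_⊎_; inj₁; inj₂; [_,_]′)
  open import Relation.Binary.PropositionalEquality
  open import Relation.Nullary using (¬_)
  open GaussianIntegers
  open TwoSquares using (prime⇒notSquare)

  euclid-ℤ : ∀ {r} → Prime r → ∀ m n → + r ∣ℤ m * n → + r ∣ℤ m ⊎ + r ∣ℤ n
  euclid-ℤ {r} r-prime m n r∣mn
    with euclidsLemma ∣ m ∣ ∣ n ∣ r-prime (subst (r ∣ℕ_) (ℤ.abs-* m n) (ℤ∣.∣⇒∣ᵤ r∣mn))
  ... | inj₁ r∣m = inj₁ (ℤ∣.∣ᵤ⇒∣ r∣m)
  ... | inj₂ r∣n = inj₂ (ℤ∣.∣ᵤ⇒∣ r∣n)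

  -- Let r = a² + b² be an odd prime and π = a + bi.  A Gaussian integer X is
  -- "free of π̄" when r ∤ Im(π X); this holds exactly when π̄ ∤ X, but all we
  -- need is that the property is multiplicative and holds for one, for π, and
  -- for every Gaussian prime of norm q ≠ r.
  module FreeOfConjugate (r a b : ℕ) (r-prime : Prime r) (a²+b²≡r : a ℕ.* a ℕ.+ b ℕ.* b ≡ r) (r≢2 : r ≢ 2) where

    A B : ℤ
    A = + a
    B = + b

    -- Im (π · X)
    ψ : Gaussian → ℤ
    ψ (x , y) = B * x + A * y

    FreeOfπ̄ : Gaussian → Set
    FreeOfπ̄ X = ¬ (+ r ∣ℤ ψ X)

    1<r : 1 ℕ.< r
    1<r = ℕ.nonTrivial⇒n>1 r {{prime⇒nonTrivial r-prime}}

    A²+B²≡r : A * A + B * B ≡ + r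
    A²+B²≡r = trans (cong₂ _+_ (sym (ℤ.pos-* a a)) (sym (ℤ.pos-* b b)))
                    (trans (sym (ℤ.pos-+ (a ℕ.* a) (b ℕ.* b))) (cong +_ a²+b²≡r))

    -- Both coordinates of π are nonzero (r is not a square), hence smaller than r.
    r∤coordinate : ∀ c d → c ℕ.* c ℕ.+ d ℕ.* d ≡ r → ¬ (r ∣ℕ c)
    r∤coordinate zero d eq _ = prime⇒notSquare r-prime d eq
    r∤coordinate c@(suc _) zero eq _ = prime⇒notSquare r-prime c (trans (sym (ℕ.+-identityʳ (c ℕ.* c))) eq)
    r∤coordinate c@(suc _) d@(suc _) eq r∣c = ℕ.<⇒≱ c<r (ℕ∣.∣⇒≤ r∣c)
      where
      c<r : c ℕ.< r
      c<r = ℕ.≤-trans (ℕ.+-monoʳ-≤ 1 (ℕ.m≤m*n c c))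
              (ℕ.≤-trans (ℕ.≤-reflexive (ℕ.+-comm 1 (c ℕ.* c)))
                (ℕ.≤-trans (ℕ.+-monoʳ-≤ (c ℕ.* c) (ℕ.*-mono-≤ {1} {d} {1} {d} (ℕ.s≤s ℕ.z≤n) (ℕ.s≤s ℕ.z≤n)))
                  (ℕ.≤-reflexive eq)))

    r∤a : ¬ (r ∣ℕ a)
    r∤a = r∤coordinate a b a²+b²≡r

    r∤b : ¬ (r ∣ℕ b)
    r∤b = r∤coordinate b a (trans (ℕ.+-comm (b ℕ.* b) (a ℕ.* a)) a²+b²≡r)

    freeOfπ̄-one : FreeOfπ̄ one
    freeOfπ̄-one r∣ψ = r∤b (ℤ∣.∣⇒∣ᵤ (subst (+ r ∣ℤ_) (ψ-one B A) r∣ψ))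
      where
      ψ-one : ∀ B A → B * + 1 + A * + 0 ≡ B
      ψ-one = solve-∀

    -- ψ(X) ψ(Y) = b ψ(XY) + r y v, so r ∤ ψ(X), ψ(Y) forces r ∤ ψ(XY).
    freeOfπ̄-· : ∀ X Y → FreeOfπ̄ X → FreeOfπ̄ Y → FreeOfπ̄ (X · Y)
    freeOfπ̄-· (x , y) (u , v) freeX freeY r∣ψXY =
      [ freeX , freeY ]′ (euclid-ℤ r-prime (ψ (x , y)) (ψ (u , v)) (subst (+ r ∣ℤ_) (sym product) r∣rhs))
      where
      identity : ∀ A B x y u v → (B * x + A * y) * (B * u + A * v) ≡
                 B * (B * (x * u - y * v) + A * (x * v + y * u)) + (A * A + B * B) * (y * v)
      identity = solve-∀
      product : ψ (x , y) * ψ (u , v) ≡ B * ψ ((x , y) · (u , v)) + + r * (y * v)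
      product = trans (identity A B x y u v) (cong (λ n → B * ψ ((x , y) · (u , v)) + n * (y * v)) A²+B²≡r)
      r∣rhs : + r ∣ℤ B * ψ ((x , y) · (u , v)) + + r * (y * v)
      r∣rhs = ℤ∣.∣m∣n⇒∣m+n (ℤ∣.∣n⇒∣m*n B r∣ψXY) (ℤ∣.∣m⇒∣m*n (y * v) (ℤ∣.∣-refl {+ r}))

    -- ψ(π) = 2ab, and r divides none of 2, a, b.
    freeOfπ̄-π : FreeOfπ̄ (A , B)
    freeOfπ̄-π r∣ψ = [ r∤2 , (λ r∣ab → [ r∤a , r∤b ]′ (euclidsLemma a b r-prime r∣ab)) ]′
                      (euclidsLemma 2 (a ℕ.* b) r-prime (ℤ∣.∣⇒∣ᵤ (subst (+ r ∣ℤ_) ψ-π r∣ψ)))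
      where
      r∤2 : ¬ (r ∣ℕ 2)
      r∤2 r∣2 = r≢2 (ℕ.≤-antisym (ℕ∣.∣⇒≤ r∣2) 1<r)
      ψ-π : B * A + A * B ≡ + (2 ℕ.* (a ℕ.* b))
      ψ-π = trans (double A B) (trans (cong (+ 2 *_) (sym (ℤ.pos-* a b))) (sym (ℤ.pos-* 2 (a ℕ.* b))))
        where
        double : ∀ A B → B * A + A * B ≡ + 2 * (A * B)
        double = solve-∀

    -- If r | ψ(C + Di) then, as (aC − bD)² + ψ² = r (C² + D²), r² divides
    -- r (C² + D²), so r divides the prime C² + D² = q, i.e. q = r.
    freeOfπ̄-prime : ∀ q C D → Prime q → C * C + D * D ≡ + q → q ≢ r → FreeOfπ̄ (C , D)
    freeOfπ̄-prime q C D q-prime C²+D²≡q q≢r r∣ψ = [ r≢1 , (λ r≡q → q≢r (sym r≡q)) ]′ (prime⇒irreducible q-prime r∣q)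
      where
      L : ℤ
      L = A * C - B * D
      N : ℤ
      N = C * C + D * D
      sumOfSquares : L * L + ψ (C , D) * ψ (C , D) ≡ + r * N
      sumOfSquares = trans (identity A B C D) (cong (_* N) A²+B²≡r)
        where
        identity : ∀ A B C D → (A * C - B * D) * (A * C - B * D) + (B * C + A * D) * (B * C + A * D)
                               ≡ (A * A + B * B) * (C * C + D * D)
        identity = solve-∀
      r∣L : + r ∣ℤ L
      r∣L = [ (λ h → h) , (λ h → h) ]′ (euclid-ℤ r-prime L L
              (ℤ∣.∣m+n∣n⇒∣m (subst (+ r ∣ℤ_) (sym sumOfSquares) (ℤ∣.∣m⇒∣m*n N (ℤ∣.∣-refl {+ r})))
                            (ℤ∣.∣m⇒∣m*n (ψ (C , D)) r∣ψ)))
      l m : ℤ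
      l = ℤ∣._∣_.quotient r∣L
      m = ℤ∣._∣_.quotient r∣ψ
      instance
        r-nonZero : NonZero (+ r)
        r-nonZero = ℕ.>-nonZero (ℕ.<-trans ℕ.z<s 1<r)
      N≡r[l²+m²] : N ≡ + r * (l * l + m * m)
      N≡r[l²+m²] = ℤ.*-cancelˡ-≡ (+ r) N _ (trans (sym sumOfSquares)
        (trans (cong₂ (λ s t → s * s + t * t) (ℤ∣._∣_.equality r∣L) (ℤ∣._∣_.equality r∣ψ)) (factor (+ r) l m)))
        where
        factor : ∀ r l m → (l * r) * (l * r) + (m * r) * (m * r) ≡ r * (r * (l * l + m * m))
        factor = solve-∀
      r∣q : r ∣ℕ q
      r∣q = ℤ∣.∣⇒∣ᵤ {+ r} {+ q} (divides (l * l + m * m) (trans (sym C²+D²≡q) (trans N≡r[l²+m²] (ℤ.*-comm (+ r) _))))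
      r≢1 : r ≢ 1
      r≢1 r≡1 = ℕ.<⇒≢ 1<r (sym r≡1)

module DivisorFactors where

  open import Data.Integer as ℤ using (+_; _*_)
  open import Data.Integer.Tactic.RingSolver using (solve-∀)
  import Data.Integer.Properties as ℤ
  open import Data.Nat as ℕ using (ℕ; suc; zero; _%_)
  import Data.Nat.Properties as ℕ
  open import Data.Nat.Divisibility as ℕ∣ using (_∣?_; divides) renaming (_∣_ to _∣ℕ_)
  open import Data.Nat.Primality using (Prime; prime⇒irreducible; prime⇒nonZero)
  open import Data.Nat.Coprimality using (Coprime; coprime-divisor)
  open import Data.Nat.ListAction using (product)
  open import Data.Bool using (Bool; true; false)
  open import Data.List using (List; []; _∷_; filter; map; upTo; cartesianProduct)
  open import Data.List.Membership.Propositional using (_∈_)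
  open import Data.List.Membership.Propositional.Properties using (∈-upTo⁺; ∈-cartesianProduct⁺; ∈-filter⁺; ∈-filter⁻)
  open import Data.List.Relation.Unary.Any using (here)
  open import Data.List.Relation.Unary.All using (All; []; _∷_)
  open import Data.Product using (_×_; _,_; proj₁; proj₂)
  open import Data.Sum using (inj₁; inj₂)
  open import Data.Empty using (⊥-elim)
  open import Relation.Binary.PropositionalEquality
  open import Relation.Nullary using (Dec; yes; no)
  open GaussianIntegers
  open TwoSquares using (fermatTwoSquares)

  -- A canonical Gaussian prime π_q above q: the first (a , b) ∈ [0, q]² with
  -- a² + b² = q.  It must be a function of q alone, because the same π_q is
  -- used in every factorisation below.

  sumOfSquares : ℕ × ℕ → ℕ
  sumOfSquares (a , b) = a ℕ.* a ℕ.+ b ℕ.* b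

  represents? : ∀ q (ab : ℕ × ℕ) → Dec (sumOfSquares ab ≡ q)
  represents? q ab = sumOfSquares ab ℕ.≟ q

  representations : ℕ → List (ℕ × ℕ)
  representations q = filter (represents? q) (cartesianProduct (upTo (suc q)) (upTo (suc q)))

  firstOr : ∀ {A : Set} → A → List A → A
  firstOr default [] = default
  firstOr _ (x ∷ _) = x

  firstOr-∈ : ∀ {A : Set} {default x : A} {L : List A} → x ∈ L → firstOr default L ∈ L
  firstOr-∈ {L = _ ∷ _} _ = here refl

  representation : ℕ → ℕ × ℕ
  representation q = firstOr (0 , 0) (representations q)

  square≤⇒≤ : ∀ a q → a ℕ.* a ℕ.≤ q → a ℕ.≤ q
  square≤⇒≤ zero q _ = ℕ.z≤n
  square≤⇒≤ (suc a) q a²≤q = ℕ.≤-trans (ℕ.m≤m*n (suc a) (suc a)) a²≤q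

  PrimeOneModFour : ℕ → Set
  PrimeOneModFour q = Prime q × q % 4 ≡ 1

  representation-correct : ∀ {q} → PrimeOneModFour q → sumOfSquares (representation q) ≡ q
  representation-correct {q} (q-prime , q%4≡1) with fermatTwoSquares q q-prime q%4≡1
  ... | a , b , a²+b²≡q = proj₂ (∈-filter⁻ (represents? q) {xs = cartesianProduct (upTo (suc q)) (upTo (suc q))}
                                    (firstOr-∈ {default = 0 , 0} found))
    where
    found : (a , b) ∈ representations q
    found = ∈-filter⁺ (represents? q)
      (∈-cartesianProduct⁺ (∈-upTo⁺ (ℕ.s≤s (square≤⇒≤ a q (ℕ.≤-trans (ℕ.m≤m+n (a ℕ.* a) (b ℕ.* b)) (ℕ.≤-reflexive a²+b²≡q)))))
                           (∈-upTo⁺ (ℕ.s≤s (square≤⇒≤ b q (ℕ.≤-trans (ℕ.m≤n+m (b ℕ.* b) (a ℕ.* a)) (ℕ.≤-reflexive a²+b²≡q))))))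
      a²+b²≡q

  gaussianPrime : ℕ → Gaussian
  gaussianPrime q = + proj₁ (representation q) , + proj₂ (representation q)

  Splits : ℕ → Set
  Splits q = norm (gaussianPrime q) ≡ + q

  splits : ∀ {q} → PrimeOneModFour q → Splits q
  splits {q} q-ok = trans (cong₂ ℤ._+_ (sym (ℤ.pos-* a a)) (sym (ℤ.pos-* b b)))
                          (trans (sym (ℤ.pos-+ (a ℕ.* a) (b ℕ.* b))) (cong +_ (representation-correct q-ok)))
    where
    a = proj₁ (representation q)
    b = proj₂ (representation q)

  -- A divisor d of a product of primes q₁ ⋯ qₙ is encoded by tagging each qᵢ
  -- as chosen (it goes into d) or not.  From such a choice we build
  --   root      ∏ (π_q if chosen, else π̄_q)      of norm q₁ ⋯ qₙ,
  --   chosenSq  ∏_{chosen} π_q²                  of norm d²,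
  -- and root · (π_{q₁} ⋯ π_{qₙ}) = (∏_{unchosen} q) · chosenSq.

  Choice : Set
  Choice = List (Bool × ℕ)

  primesOf : Choice → List ℕ
  primesOf = map proj₂

  choose : ℕ → List ℕ → Choice
  choose d [] = []
  choose d (q ∷ qs) with q ∣? d
  ... | yes (divides c _) = (true , q) ∷ choose c qs
  ... | no _ = (false , q) ∷ choose d qs

  primesOf-choose : ∀ d qs → primesOf (choose d qs) ≡ qs
  primesOf-choose d [] = refl
  primesOf-choose d (q ∷ qs) with q ∣? d
  ... | yes (divides c _) = cong (q ∷_) (primesOf-choose c qs)
  ... | no _ = cong (q ∷_) (primesOf-choose d qs)

  chosen unchosen : Choice → ℕ
  chosen [] = 1
  chosen ((true , q) ∷ cs) = q ℕ.* chosen cs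
  chosen ((false , q) ∷ cs) = chosen cs
  unchosen [] = 1
  unchosen ((true , q) ∷ cs) = unchosen cs
  unchosen ((false , q) ∷ cs) = q ℕ.* unchosen cs

  chosen*unchosen : ∀ cs → chosen cs ℕ.* unchosen cs ≡ product (primesOf cs)
  chosen*unchosen [] = refl
  chosen*unchosen ((true , q) ∷ cs) = trans (ℕ.*-assoc q (chosen cs) (unchosen cs)) (cong (q ℕ.*_) (chosen*unchosen cs))
  chosen*unchosen ((false , q) ∷ cs) = trans (ℕ.*-comm (chosen cs) (q ℕ.* unchosen cs))
    (trans (ℕ.*-assoc q (unchosen cs) (chosen cs))
           (cong (q ℕ.*_) (trans (ℕ.*-comm (unchosen cs) (chosen cs)) (chosen*unchosen cs))))

  chosen-choose : ∀ d qs → All Prime qs → d ∣ℕ product qs → chosen (choose d qs) ≡ d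
  chosen-choose d [] _ d∣1 = sym (ℕ∣.∣1⇒≡1 d∣1)
  chosen-choose d (q ∷ qs) (q-prime ∷ primes) d∣qΠ with q ∣? d
  ... | yes (divides c d≡cq) =
    trans (cong (q ℕ.*_) (chosen-choose c qs primes c∣Π)) (trans (ℕ.*-comm q c) (sym d≡cq))
    where
    instance _ = prime⇒nonZero q-prime
    c∣Π : c ∣ℕ product qs
    c∣Π = ℕ∣.*-cancelˡ-∣ q (subst (_∣ℕ (q ℕ.* product qs)) (trans d≡cq (ℕ.*-comm c q)) d∣qΠ)
  ... | no q∤d = chosen-choose d qs primes (coprime-divisor d⊥q d∣qΠ)
    where
    d⊥q : Coprime d q
    d⊥q (e∣d , e∣q) with prime⇒irreducible q-prime e∣q
    ... | inj₁ e≡1 = e≡1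
    ... | inj₂ refl = ⊥-elim (q∤d e∣d)

  root chosenSq : Choice → Gaussian
  root [] = one
  root ((true , q) ∷ cs) = gaussianPrime q · root cs
  root ((false , q) ∷ cs) = conj (gaussianPrime q) · root cs
  chosenSq [] = one
  chosenSq ((true , q) ∷ cs) = (gaussianPrime q · gaussianPrime q) · chosenSq cs
  chosenSq ((false , q) ∷ cs) = chosenSq cs

  Γ : List ℕ → Gaussian
  Γ [] = one
  Γ (q ∷ qs) = gaussianPrime q · Γ qs

  -- Multiplying root by Γ turns each π̄_q π_q into q and each π_q π_q into π_q².
  root-·-Γ : ∀ cs → All Splits (primesOf cs) → root cs · Γ (primesOf cs) ≡ scale (+ unchosen cs) (chosenSq cs)
  root-·-Γ [] _ = refl
  root-·-Γ ((true , q) ∷ cs) (_ ∷ splits) = begin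
    (π · root cs) · (π · Γ (primesOf cs)) ≡⟨ ·-interchange π (root cs) π (Γ (primesOf cs)) ⟩
    (π · π) · (root cs · Γ (primesOf cs)) ≡⟨ cong ((π · π) ·_) (root-·-Γ cs splits) ⟩
    (π · π) · scale U (chosenSq cs)       ≡⟨ ·-scale U (π · π) (chosenSq cs) ⟩
    scale U ((π · π) · chosenSq cs)       ∎
    where
    open ≡-Reasoning
    π = gaussianPrime q
    U = + unchosen cs
  root-·-Γ ((false , q) ∷ cs) (q-splits ∷ splits) = begin
    (conj π · root cs) · (π · Γ (primesOf cs)) ≡⟨ ·-interchange (conj π) (root cs) π (Γ (primesOf cs)) ⟩
    (conj π · π) · (root cs · Γ (primesOf cs)) ≡⟨ cong₂ _·_ (trans (conj-·-self π) (cong (λ n → scale n one) q-splits))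
                                                           (root-·-Γ cs splits) ⟩
    scale (+ q) one · scale U (chosenSq cs)    ≡⟨ scale-one-· (+ q) (scale U (chosenSq cs)) ⟩
    scale (+ q) (scale U (chosenSq cs))        ≡⟨ scale-scale (+ q) U (chosenSq cs) ⟩
    scale (+ q * U) (chosenSq cs)              ≡⟨ cong (λ n → scale n (chosenSq cs)) (sym (ℤ.pos-* q (unchosen cs))) ⟩
    scale (+ (q ℕ.* unchosen cs)) (chosenSq cs) ∎
    where
    open ≡-Reasoning
    π = gaussianPrime q
    U = + unchosen cs

  norm-root : ∀ cs → All Splits (primesOf cs) → norm (root cs) ≡ + product (primesOf cs)
  norm-root [] _ = refl
  norm-root ((true , q) ∷ cs) (q-splits ∷ splits) =
    trans (norm-· (gaussianPrime q) (root cs))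
          (trans (cong₂ _*_ q-splits (norm-root cs splits)) (sym (ℤ.pos-* q _)))
  norm-root ((false , q) ∷ cs) (q-splits ∷ splits) =
    trans (norm-· (conj (gaussianPrime q)) (root cs))
          (trans (cong₂ _*_ (trans (norm-conj (gaussianPrime q)) q-splits) (norm-root cs splits)) (sym (ℤ.pos-* q _)))

  norm-chosenSq : ∀ cs → All Splits (primesOf cs) → norm (chosenSq cs) ≡ + (chosen cs ℕ.* chosen cs)
  norm-chosenSq [] _ = refl
  norm-chosenSq ((true , q) ∷ cs) (q-splits ∷ splits) = begin
    norm ((π · π) · chosenSq cs)                ≡⟨ norm-· (π · π) (chosenSq cs) ⟩
    norm (π · π) * norm (chosenSq cs)           ≡⟨ cong (_* norm (chosenSq cs)) (norm-· π π) ⟩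
    (norm π * norm π) * norm (chosenSq cs)      ≡⟨ cong₂ (λ s t → (s * s) * t) q-splits (norm-chosenSq cs splits) ⟩
    (+ q * + q) * + (C ℕ.* C)                   ≡⟨ cong ((+ q * + q) *_) (ℤ.pos-* C C) ⟩
    (+ q * + q) * (+ C * + C)                   ≡⟨ regroup (+ q) (+ C) ⟩
    (+ q * + C) * (+ q * + C)                   ≡⟨ cong₂ _*_ (sym (ℤ.pos-* q C)) (sym (ℤ.pos-* q C)) ⟩
    + (q ℕ.* C) * + (q ℕ.* C)                   ≡⟨ sym (ℤ.pos-* (q ℕ.* C) (q ℕ.* C)) ⟩
    + (q ℕ.* C ℕ.* (q ℕ.* C))                   ∎
    where
    open ≡-Reasoning
    π = gaussianPrime q
    C = chosen cs
    regroup : ∀ Q K → (Q * Q) * (K * K) ≡ (Q * K) * (Q * K)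
    regroup = solve-∀
  norm-chosenSq ((false , q) ∷ cs) (_ ∷ splits) = norm-chosenSq cs splits

module Primitivity where

  open import Data.Integer as ℤ using (+_; _+_; _*_; ∣_∣)
  import Data.Integer.Properties as ℤ
  open import Data.Integer.Divisibility.Signed as ℤ∣ using () renaming (_∣_ to _∣ℤ_)
  open import Data.Nat as ℕ using (ℕ; suc; zero)
  import Data.Nat.Properties as ℕ
  open import Data.Nat.Divisibility as ℕ∣ using () renaming (_∣_ to _∣ℕ_)
  open import Data.Nat.Primality using (Prime; euclidsLemma; productOfPrimes≢0)
  open import Data.Nat.Primality.Factorisation using (factorise; PrimeFactorisation; factorisationHasAllPrimeFactors)
  open import Data.Nat.Coprimality using (Coprime; coprime⇒gcd≡1)
  open import Data.Nat.GCD using (gcd; c*gcd[m,n]≡gcd[cm,cn])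
  open import Data.Nat.ListAction using (product)
  open import Data.Bool using (true; false)
  open import Data.List using ([]; _∷_)
  open import Data.List.Relation.Unary.All as All using (All; _∷_)
  open import Data.Product using (_,_; proj₁; proj₂)
  open import Data.Sum using ([_,_]′)
  open import Data.Empty using (⊥; ⊥-elim)
  open import Relation.Binary.PropositionalEquality
  open import Relation.Nullary using (yes; no)
  open GaussianIntegers
  open ConjugateDivisor
  open DivisorFactors

  content : Gaussian → ℕ
  content (x , y) = gcd ∣ x ∣ ∣ y ∣

  content-scale : ∀ n X → content (scale (+ n) X) ≡ n ℕ.* content X
  content-scale n (x , y) = trans (cong₂ gcd (ℤ.abs-* (+ n) x) (ℤ.abs-* (+ n) y)) (sym (c*gcd[m,n]≡gcd[cm,cn] n ∣ x ∣ ∣ y ∣))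

  content-neg : ∀ X → content (neg X) ≡ content X
  content-neg (x , y) = cong₂ gcd (ℤ.∣-i∣≡∣i∣ x) (ℤ.∣-i∣≡∣i∣ y)

  noPrimeDivisor⇒≡1 : ∀ e → e ≢ 0 → (∀ r → Prime r → r ∣ℕ e → ⊥) → e ≡ 1
  noPrimeDivisor⇒≡1 zero e≢0 _ = ⊥-elim (e≢0 refl)
  noPrimeDivisor⇒≡1 e@(suc _) _ noPrime = byFactors (PrimeFactorisation.factors f)
    (PrimeFactorisation.isFactorisation f) (PrimeFactorisation.factorsPrime f)
    where
    f = factorise e
    byFactors : ∀ rs → e ≡ product rs → All Prime rs → e ≡ 1
    byFactors [] e≡1 _ = e≡1
    byFactors (r ∷ rs) e≡rΠ (r-prime ∷ _) =
      ⊥-elim (noPrime r r-prime (ℕ∣.divides (product rs) (trans e≡rΠ (ℕ.*-comm r (product rs)))))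

  oneModFour⇒≢2 : ∀ {r} → r ℕ.% 4 ≡ 1 → r ≢ 2
  oneModFour⇒≢2 () refl

  -- For a prime r ≡ 1 (mod 4) with π = π_r, every chosenSq is free of π̄:
  -- each factor π_q is, whether q = r or q ≠ r.
  module FreeOfConjugateOf (r : ℕ) (r-ok : PrimeOneModFour r) where
    open FreeOfConjugate r (proj₁ (representation r)) (proj₂ (representation r)) (proj₁ r-ok)
                         (representation-correct r-ok) (oneModFour⇒≢2 (proj₂ r-ok)) public

    freeOfπ̄-gaussianPrime : ∀ {q} → PrimeOneModFour q → FreeOfπ̄ (gaussianPrime q)
    freeOfπ̄-gaussianPrime {q} q-ok with q ℕ.≟ r
    ... | yes refl = freeOfπ̄-π
    ... | no q≢r = freeOfπ̄-prime q _ _ (proj₁ q-ok) (splits q-ok) q≢r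

    freeOfπ̄-chosenSq : ∀ cs → All PrimeOneModFour (primesOf cs) → FreeOfπ̄ (chosenSq cs)
    freeOfπ̄-chosenSq [] _ = freeOfπ̄-one
    freeOfπ̄-chosenSq ((true , q) ∷ cs) (q-ok ∷ oks) =
      freeOfπ̄-· (π · π) (chosenSq cs) (freeOfπ̄-· π π freeπ freeπ) (freeOfπ̄-chosenSq cs oks)
      where
      π = gaussianPrime q
      freeπ = freeOfπ̄-gaussianPrime q-ok
    freeOfπ̄-chosenSq ((false , q) ∷ cs) (_ ∷ oks) = freeOfπ̄-chosenSq cs oks

  prime∣square⇒∣ : ∀ {r} m → Prime r → r ∣ℕ m ℕ.* m → r ∣ℕ m
  prime∣square⇒∣ m r-prime r∣mm = [ (λ h → h) , (λ h → h) ]′ (euclidsLemma m m r-prime r∣mm)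

  common∣norm : ∀ {e} X → e ∣ℤ proj₁ X → e ∣ℤ proj₂ X → e ∣ℤ norm X
  common∣norm (x , y) e∣x e∣y = ℤ∣.∣m∣n⇒∣m+n (ℤ∣.∣n⇒∣m*n x e∣x) (ℤ∣.∣n⇒∣m*n y e∣y)

  chosen-nonZero : ∀ cs → All Prime (primesOf cs) → ℕ.NonZero (chosen cs)
  chosen-nonZero cs primes = ℕ.m*n≢0⇒m≢0 (chosen cs) {{subst ℕ.NonZero (sym (chosen*unchosen cs)) (productOfPrimes≢0 primes)}}

  primeDivisor-chosen : ∀ cs → All PrimeOneModFour (primesOf cs) → ∀ {r} → Prime r → r ∣ℕ chosen cs → PrimeOneModFour r
  primeDivisor-chosen cs oks r-prime r∣C = All.lookup oks (factorisationHasAllPrimeFactors r-prime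
    (ℕ∣.∣-trans r∣C (ℕ∣.divides (unchosen cs) (trans (sym (chosen*unchosen cs)) (ℕ.*-comm (chosen cs) (unchosen cs)))))
    (All.map proj₁ oks))

  -- A prime r dividing both
  -- coordinates of Z = chosenSq² divides N(Z) = d⁴, hence is one of the primes
  -- q ≡ 1 (mod 4); but then r | Im(π_r Z), contradicting freeness of Z.
  chosenSq²-primitive : ∀ cs → All PrimeOneModFour (primesOf cs) → content (chosenSq cs · chosenSq cs) ≡ 1
  chosenSq²-primitive cs oks = coprime⇒gcd≡1 coprime
    where
    Y = chosenSq cs
    Z = Y · Y
    C = chosen cs
    C⁴ = (C ℕ.* C) ℕ.* (C ℕ.* C)
    norm-Z : norm Z ≡ + C⁴
    norm-Z = trans (norm-· Y Y) (trans (cong₂ _*_ (norm-chosenSq cs splitting) (norm-chosenSq cs splitting))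
                                       (sym (ℤ.pos-* (C ℕ.* C) (C ℕ.* C))))
      where splitting = All.map splits oks
    instance
      C-nonZero : ℕ.NonZero C
      C-nonZero = chosen-nonZero cs (All.map proj₁ oks)
      C²-nonZero : ℕ.NonZero (C ℕ.* C)
      C²-nonZero = ℕ.m*n≢0 C C
    C⁴≢0 : C⁴ ≢ 0
    C⁴≢0 = ℕ.≢-nonZero⁻¹ C⁴ {{ℕ.m*n≢0 (C ℕ.* C) (C ℕ.* C)}}
    coprime : Coprime ∣ proj₁ Z ∣ ∣ proj₂ Z ∣
    coprime {e} (e∣x , e∣y) = noPrimeDivisor⇒≡1 e e≢0 noPrime
      where
      e≢0 : e ≢ 0
      e≢0 refl = C⁴≢0 (ℤ.+-injective (trans (sym norm-Z)
                   (cong₂ (λ s t → s * s + t * t) (ℤ.∣i∣≡0⇒i≡0 {proj₁ Z} (ℕ∣.0∣⇒≡0 e∣x)) (ℤ.∣i∣≡0⇒i≡0 {proj₂ Z} (ℕ∣.0∣⇒≡0 e∣y)))))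
      noPrime : ∀ r → Prime r → r ∣ℕ e → ⊥
      noPrime r r-prime r∣e = freeOfπ̄-· Y Y freeY freeY r∣ψZ
        where
        r∣x : + r ∣ℤ proj₁ Z
        r∣x = ℤ∣.∣ᵤ⇒∣ (ℕ∣.∣-trans r∣e e∣x)
        r∣y : + r ∣ℤ proj₂ Z
        r∣y = ℤ∣.∣ᵤ⇒∣ (ℕ∣.∣-trans r∣e e∣y)
        r∣C : r ∣ℕ C
        r∣C = prime∣square⇒∣ C r-prime (prime∣square⇒∣ (C ℕ.* C) r-prime
                (ℤ∣.∣⇒∣ᵤ {+ r} {+ C⁴} (subst (+ r ∣ℤ_) norm-Z (common∣norm Z r∣x r∣y))))
        open FreeOfConjugateOf r (primeDivisor-chosen cs oks r-prime r∣C)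
        freeY : FreeOfπ̄ Y
        freeY = freeOfπ̄-chosenSq cs oks
        r∣ψZ : + r ∣ℤ ψ Z
        r∣ψZ = ℤ∣.∣m∣n⇒∣m+n (ℤ∣.∣n⇒∣m*n B r∣x) (ℤ∣.∣n⇒∣m*n A r∣y)

module CircleGeometry where

  open import Data.Integer as ℤ using (ℤ; +_; -[1+_]; _+_; _*_; -_; _-_; ∣_∣; NonZero)
  open import Data.Integer.Tactic.RingSolver using (solve-∀)
  import Data.Integer.Properties as ℤ
  open import Data.Nat as ℕ using (ℕ)
  import Data.Nat.Properties as ℕ
  open import Data.Product using (_×_; _,_; proj₁; proj₂; ∃)
  open import Data.Sum using (_⊎_; inj₁; inj₂)
  open import Data.Empty using (⊥-elim)
  open import Relation.Binary.PropositionalEquality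
  open import Relation.Binary.Definitions using (tri<; tri≈; tri>)
  open import Defs using (dist²; HasIntegerDistance; Collinear)
  open GaussianIntegers

  origin : Gaussian
  origin = (+ 0 , + 0)

  dist²-to-origin : ∀ X → dist² X origin ≡ norm X
  dist²-to-origin (x , y) = identity x y
    where
    identity : ∀ x y → (x - + 0) * (x - + 0) + (y - + 0) * (y - + 0) ≡ x * x + y * y
    identity = solve-∀

  dist²-from-origin : ∀ X → dist² origin X ≡ norm X
  dist²-from-origin (x , y) = identity x y
    where
    identity : ∀ x y → (+ 0 - x) * (+ 0 - x) + (+ 0 - y) * (+ 0 - y) ≡ x * x + y * y
    identity = solve-∀

  dist²-neg-neg : ∀ X Y → dist² (neg X) (neg Y) ≡ dist² X Y
  dist²-neg-neg (x , y) (u , v) = identity x y u v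
    where
    identity : ∀ x y u v → (- x - - u) * (- x - - u) + (- y - - v) * (- y - - v) ≡ (x - u) * (x - u) + (y - v) * (y - v)
    identity = solve-∀

  dist²-neg-swap : ∀ X Y → dist² (neg X) Y ≡ dist² X (neg Y)
  dist²-neg-swap (x , y) (u , v) = identity x y u v
    where
    identity : ∀ x y u v → (- x - u) * (- x - u) + (- y - v) * (- y - v) ≡ (x - - u) * (x - - u) + (y - - v) * (y - - v)
    identity = solve-∀

  twiceIm twiceRe : Gaussian → Gaussian → ℤ
  twiceIm (a , b) (c , d) = + 2 * (b * c - a * d)
  twiceRe (a , b) (c , d) = + 2 * (a * c + b * d)

  dist²-squares : ∀ A B → dist² (A · A) (B · B) ≡ (norm A - norm B) * (norm A - norm B) + twiceIm A B * twiceIm A B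
  dist²-squares (a , b) (c , d) = identity a b c d
    where
    identity : ∀ a b c d →
      ((a * a - b * b) - (c * c - d * d)) * ((a * a - b * b) - (c * c - d * d)) +
      ((a * b + b * a) - (c * d + d * c)) * ((a * b + b * a) - (c * d + d * c))
      ≡ ((a * a + b * b) - (c * c + d * d)) * ((a * a + b * b) - (c * c + d * d)) +
        (+ 2 * (b * c - a * d)) * (+ 2 * (b * c - a * d))
    identity = solve-∀

  dist²-square-negSquare : ∀ A B → dist² (A · A) (neg (B · B)) ≡ (norm A - norm B) * (norm A - norm B) + twiceRe A B * twiceRe A B
  dist²-square-negSquare (a , b) (c , d) = identity a b c d
    where
    identity : ∀ a b c d →
      ((a * a - b * b) - - (c * c - d * d)) * ((a * a - b * b) - - (c * c - d * d)) +
      ((a * b + b * a) - - (c * d + d * c)) * ((a * b + b * a) - - (c * d + d * c))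
      ≡ ((a * a + b * b) - (c * c + d * d)) * ((a * a + b * b) - (c * c + d * d)) +
        (+ 2 * (a * c + b * d)) * (+ 2 * (a * c + b * d))
    identity = solve-∀

  |t|²≡t² : ∀ t → + ∣ t ∣ * + ∣ t ∣ ≡ t * t
  |t|²≡t² (+ n) = refl
  |t|²≡t² -[1+ n ] = refl

  integral-if-square : ∀ X Y n t → dist² X Y ≡ (n - n) * (n - n) + t * t → HasIntegerDistance X Y
  integral-if-square X Y n t eq = ∣ t ∣ , (begin
    dist² X Y                   ≡⟨ eq ⟩
    (n - n) * (n - n) + t * t   ≡⟨ cong (λ z → z * z + t * t) (ℤ.+-inverseʳ n) ⟩
    + 0 * + 0 + t * t           ≡⟨ ℤ.+-identityˡ (t * t) ⟩
    t * t                       ≡⟨ sym (|t|²≡t² t) ⟩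
    + ∣ t ∣ * + ∣ t ∣           ∎)
    where open ≡-Reasoning

  SquarePoint : ℤ → Gaussian → Set
  SquarePoint n X = ∃ λ A → norm A ≡ n × (X ≡ A · A ⊎ X ≡ neg (A · A))

  -- Any two such points are at integer distance (|A² ∓ B²| = 2 |Im or Re (A B̄)|).
  integral-SquarePoints : ∀ {n X Y} → SquarePoint n X → SquarePoint n Y → HasIntegerDistance X Y
  integral-SquarePoints {n} (A , NA , X≡) (B , NB , Y≡) = byCases X≡ Y≡
    where
    equalNorms : ∀ t → (norm A - norm B) * (norm A - norm B) + t * t ≡ (n - n) * (n - n) + t * t
    equalNorms t = cong₂ (λ s u → (s - u) * (s - u) + t * t) NA NB
    ++ : HasIntegerDistance (A · A) (B · B)
    ++ = integral-if-square (A · A) (B · B) n (twiceIm A B) (trans (dist²-squares A B) (equalNorms (twiceIm A B)))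
    +- : HasIntegerDistance (A · A) (neg (B · B))
    +- = integral-if-square (A · A) (neg (B · B)) n (twiceRe A B) (trans (dist²-square-negSquare A B) (equalNorms (twiceRe A B)))
    byCases : ∀ {X Y} → (X ≡ A · A ⊎ X ≡ neg (A · A)) → (Y ≡ B · B ⊎ Y ≡ neg (B · B)) → HasIntegerDistance X Y
    byCases (inj₁ refl) (inj₁ refl) = ++
    byCases (inj₁ refl) (inj₂ refl) = +-
    byCases (inj₂ refl) (inj₁ refl) = let (d , eq) = +- in d , trans (dist²-neg-swap (A · A) (B · B)) eq
    byCases (inj₂ refl) (inj₂ refl) = let (d , eq) = ++ in d , trans (dist²-neg-neg (A · A) (B · B)) eq

  norm-SquarePoint : ∀ {R : ℕ} {X} → SquarePoint (+ R) X → norm X ≡ + R * + R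
  norm-SquarePoint (A , NA , inj₁ refl) = trans (norm-· A A) (cong₂ _*_ NA NA)
  norm-SquarePoint (A , NA , inj₂ refl) = trans (norm-neg (A · A)) (trans (norm-· A A) (cong₂ _*_ NA NA))

  integral-to-origin : ∀ {R : ℕ} {X} → SquarePoint (+ R) X → HasIntegerDistance X origin
  integral-to-origin {R} {X} P = R , trans (dist²-to-origin X) (norm-SquarePoint P)

  integral-from-origin : ∀ {R : ℕ} {X} → SquarePoint (+ R) X → HasIntegerDistance origin X
  integral-from-origin {R} {X} P = R , trans (dist²-from-origin X) (norm-SquarePoint P)

  m²≡n²⇒m≡n : ∀ m n → m ℕ.* m ≡ n ℕ.* n → m ≡ n
  m²≡n²⇒m≡n m n eq with ℕ.<-cmp m n
  ... | tri< m<n _ _ = ⊥-elim (ℕ.<-irrefl eq (ℕ.*-mono-< m<n m<n))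
  ... | tri≈ _ m≡n _ = m≡n
  ... | tri> _ _ n<m = ⊥-elim (ℕ.<-irrefl (sym eq) (ℕ.*-mono-< n<m n<m))

  t²≡M²⇒t≡±M : ∀ t M → t * t ≡ M * M → t ≡ M ⊎ t ≡ - M
  t²≡M²⇒t≡±M t M eq =
    sameAbs t M (m²≡n²⇒m≡n ∣ t ∣ ∣ M ∣ (trans (sym (ℤ.abs-* t t)) (trans (cong ∣_∣ eq) (ℤ.abs-* M M))))
    where
    sameAbs : ∀ t M → ∣ t ∣ ≡ ∣ M ∣ → t ≡ M ⊎ t ≡ - M
    sameAbs (+ m) (+ n) eq = inj₁ (cong +_ eq)
    sameAbs (+ m) -[1+ n ] eq = inj₂ (cong +_ eq)
    sameAbs -[1+ m ] (+ n) refl = inj₂ refl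
    sameAbs -[1+ m ] -[1+ n ] refl = inj₁ refl

  inner : Gaussian → Gaussian → ℤ
  inner (x , y) (u , v) = x * u + y * v

  -- For Q, S collinear with the origin (vanishing cross product c):
  -- ⟨Q, S⟩² = ⟨Q, S⟩² + c² = N(Q) N(S)  (Lagrange's identity) ...
  collinear⇒inner² : ∀ Q S → Collinear origin Q S → inner Q S * inner Q S ≡ norm Q * norm S
  collinear⇒inner² (x , y) (u , v) c≡0 =
    trans (sym (ℤ.+-identityʳ (t * t))) (trans (cong (λ c → t * t + c * c) (sym c≡0)) (lagrange x y u v))
    where
    t = x * u + y * v
    lagrange : ∀ x y u v → (x * u + y * v) * (x * u + y * v) +
                 ((x - + 0) * (v - + 0) - (y - + 0) * (u - + 0)) * ((x - + 0) * (v - + 0) - (y - + 0) * (u - + 0))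
               ≡ (x * x + y * y) * (u * u + v * v)
    lagrange = solve-∀

  -- ... and N(Q) S = ⟨Q, S⟩ Q + c (−y, x) = ⟨Q, S⟩ Q.
  collinear⇒proportional : ∀ Q S → Collinear origin Q S → scale (norm Q) S ≡ scale (inner Q S) Q
  collinear⇒proportional (x , y) (u , v) c≡0 = cong₂ _,_
    (trans (decompose₁ x y u v) (trans (cong (λ c → x * t - y * c) c≡0) (dropZero₁ x y t)))
    (trans (decompose₂ x y u v) (trans (cong (λ c → y * t + x * c) c≡0) (dropZero₂ x y t)))
    where
    t = x * u + y * v
    decompose₁ : ∀ x y u v → (x * x + y * y) * u ≡ x * (x * u + y * v) - y * ((x - + 0) * (v - + 0) - (y - + 0) * (u - + 0))
    decompose₁ = solve-∀
    decompose₂ : ∀ x y u v → (x * x + y * y) * v ≡ y * (x * u + y * v) + x * ((x - + 0) * (v - + 0) - (y - + 0) * (u - + 0))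
    decompose₂ = solve-∀
    dropZero₁ : ∀ x y t → x * t - y * + 0 ≡ t * x
    dropZero₁ = solve-∀
    dropZero₂ : ∀ x y t → y * t + x * + 0 ≡ t * y
    dropZero₂ = solve-∀

  scale-injective : ∀ M {X Y} → M ≢ + 0 → scale M X ≡ scale M Y → X ≡ Y
  scale-injective M {a , b} {c , d} M≢0 eq =
    cong₂ _,_ (ℤ.*-cancelˡ-≡ M a c (cong proj₁ eq)) (ℤ.*-cancelˡ-≡ M b d (cong proj₂ eq))
    where
    instance
      M-nonZero : NonZero M
      M-nonZero = ℤ.≢-nonZero M≢0

  scale-neg : ∀ M X → scale (- M) X ≡ scale M (neg X)
  scale-neg M (a , b) = cong₂ _,_ (negSwap M a) (negSwap M b)
    where
    negSwap : ∀ M a → - M * a ≡ M * - a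
    negSwap = solve-∀

  -- Two points Q, S of equal nonzero norm M that are collinear with the origin
  -- are equal or antipodal: ⟨Q, S⟩² = M², so ⟨Q, S⟩ = ±M and M S = ±M Q.
  collinear-with-origin : ∀ Q S M → norm Q ≡ M → norm S ≡ M → M ≢ + 0 →
                          Collinear origin Q S → S ≡ Q ⊎ S ≡ neg Q
  collinear-with-origin Q S M NQ NS M≢0 collinear =
    byInner (t²≡M²⇒t≡±M (inner Q S) M (trans (collinear⇒inner² Q S collinear) (cong₂ _*_ NQ NS)))
    where
    MS≡tQ : scale M S ≡ scale (inner Q S) Q
    MS≡tQ = trans (cong (λ n → scale n S) (sym NQ)) (collinear⇒proportional Q S collinear)
    byInner : inner Q S ≡ M ⊎ inner Q S ≡ - M → S ≡ Q ⊎ S ≡ neg Q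
    byInner (inj₁ t≡M) = inj₁ (scale-injective M M≢0 (trans MS≡tQ (cong (λ t → scale t Q) t≡M)))
    byInner (inj₂ t≡-M) = inj₂ (scale-injective M M≢0
                                  (trans MS≡tQ (trans (cong (λ t → scale t Q) t≡-M) (scale-neg M Q))))

module Construction where

  open import Data.Integer as ℤ using (+_; -[1+_]; _+_; _*_; -_)
  import Data.Integer.Properties as ℤ
  open import Data.Nat as ℕ using (ℕ; suc; _%_)
  import Data.Nat.Properties as ℕ
  open import Data.Nat.Divisibility as ℕ∣ using (_∣?_) renaming (_∣_ to _∣ℕ_)
  open import Data.Nat.Primality using (Prime)
  open import Data.Nat.Primality.Factorisation using (factorise; PrimeFactorisation)
  open import Data.Nat.ListAction using (product)
  open import Data.Nat.ListAction.Properties using (∈⇒∣product)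
  open import Data.List using (List; []; _∷_; length; filter; map; upTo)
  open import Data.List.Membership.Propositional using (_∈_)
  open import Data.List.Membership.Propositional.Properties using (∈-map⁺; ∈-upTo⁺; ∈-filter⁺; ∈-filter⁻)
  open import Data.List.Relation.Unary.Any using (here; there)
  open import Data.List.Relation.Unary.All as All using (All; []; _∷_)
  open import Data.List.Relation.Unary.All.Properties using (All¬⇒¬Any)
  open import Data.List.Relation.Unary.Unique.Propositional using (Unique; []; _∷_)
  import Data.List.Relation.Unary.Unique.Propositional.Properties as Unique
  open import Data.Product using (_×_; _,_; proj₁; proj₂; ∃)
  open import Data.Sum using (_⊎_; inj₁; inj₂)
  open import Data.Empty using (⊥)
  open import Relation.Binary.PropositionalEquality
  open import Defs using (dist²; HasIntegerDistance; Collinear; NotAllCollinear; τ)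
  open GaussianIntegers
  open DivisorFactors
  open Primitivity
  open CircleGeometry

  withAntipodes : (ℕ → Gaussian) → List ℕ → List Gaussian
  withAntipodes P [] = []
  withAntipodes P (d ∷ ds) = P d ∷ neg (P d) ∷ withAntipodes P ds

  length-withAntipodes : ∀ P ds → length (withAntipodes P ds) ≡ 2 ℕ.* length ds
  length-withAntipodes P [] = refl
  length-withAntipodes P (d ∷ ds) =
    trans (cong (λ n → suc (suc n)) (length-withAntipodes P ds)) (sym (ℕ.*-suc 2 (length ds)))

  ∈-withAntipodes⁻ : ∀ P ds {X} → X ∈ withAntipodes P ds → ∃ λ d → d ∈ ds × (X ≡ P d ⊎ X ≡ neg (P d))
  ∈-withAntipodes⁻ P (d ∷ ds) (here X≡) = d , here refl , inj₁ X≡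
  ∈-withAntipodes⁻ P (d ∷ ds) (there (here X≡)) = d , here refl , inj₂ X≡
  ∈-withAntipodes⁻ P (d ∷ ds) (there (there X∈)) =
    let (d′ , d′∈ , X≡) = ∈-withAntipodes⁻ P ds X∈ in d′ , there d′∈ , X≡

  ∈-withAntipodes⁺ : ∀ P ds {d} → d ∈ ds → P d ∈ withAntipodes P ds
  ∈-withAntipodes⁺ P (d ∷ ds) (here refl) = here refl
  ∈-withAntipodes⁺ P (d ∷ ds) (there d∈) = there (there (∈-withAntipodes⁺ P ds d∈))

  withAntipodes-unique : ∀ P ds → Unique ds → (∀ d → P d ≢ neg (P d)) →
    (∀ {d d′} → d ∈ ds → d′ ∈ ds → P d ≡ P d′ ⊎ P d ≡ neg (P d′) → d ≡ d′) → Unique (withAntipodes P ds)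
  withAntipodes-unique P [] _ _ _ = []
  withAntipodes-unique P (d ∷ ds) (d∉ds ∷ u) notSelfAntipodal injective =
    (notSelfAntipodal d ∷ All.tabulate (differs inj₁ inj₂)) ∷
    All.tabulate (differs (λ e → inj₂ (trans (sym (neg-involutive (P d))) (cong neg e)))
                          (λ e → inj₁ (trans (sym (neg-involutive (P d))) (trans (cong neg e) (neg-involutive _))))) ∷
    withAntipodes-unique P ds u notSelfAntipodal (λ d∈ d′∈ → injective (there d∈) (there d′∈))
    where
    d∉ : ∀ {d′} → d′ ∈ ds → d ≢ d′
    d∉ {d′} d′∈ d≡d′ = All¬⇒¬Any d∉ds (subst (_∈ ds) (sym d≡d′) d′∈)
    -- Y ∈ {P d, −P d} differs from every later entry, since Y = ±P d′ would
    -- give P d = ±P d′ and hence d = d′ ∈ ds.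
    differs : ∀ {Y} → (∀ {d′} → Y ≡ P d′ → P d ≡ P d′ ⊎ P d ≡ neg (P d′)) →
                      (∀ {d′} → Y ≡ neg (P d′) → P d ≡ P d′ ⊎ P d ≡ neg (P d′)) →
                      ∀ {X} → X ∈ withAntipodes P ds → Y ≢ X
    differs same anti X∈ Y≡X with ∈-withAntipodes⁻ P ds X∈
    ... | d′ , d′∈ , inj₁ refl = d∉ d′∈ (injective (here refl) (there d′∈) (same Y≡X))
    ... | d′ , d′∈ , inj₂ refl = d∉ d′∈ (injective (here refl) (there d′∈) (anti Y≡X))

  module PointSet (R : ℕ) (1<R : 1 ℕ.< R) (oneModFour : ∀ p → Prime p → p ∣ℕ R → p % 4 ≡ 1) where

    instance
      R-nonZero : ℕ.NonZero R
      R-nonZero = ℕ.>-nonZero (ℕ.<-trans ℕ.z<s 1<R)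

    factorisation = factorise R
    factors : List ℕ
    factors = PrimeFactorisation.factors factorisation
    R≡Πfactors : R ≡ product factors
    R≡Πfactors = PrimeFactorisation.isFactorisation factorisation

    factors-ok : All PrimeOneModFour factors
    factors-ok = All.tabulate λ {q} q∈ → let q-prime = All.lookup (PrimeFactorisation.factorsPrime factorisation) q∈
      in q-prime , oneModFour q q-prime (subst (q ∣ℕ_) (sym R≡Πfactors) (∈⇒∣product q∈))

    choice : ℕ → Choice
    choice d = choose d factors

    choice-ok : ∀ d → All PrimeOneModFour (primesOf (choice d))
    choice-ok d = subst (All PrimeOneModFour) (sym (primesOf-choose d factors)) factors-ok

    choice-splits : ∀ d → All Splits (primesOf (choice d))
    choice-splits d = All.map splits (choice-ok d)

    chosen*unchosen≡R : ∀ d → chosen (choice d) ℕ.* unchosen (choice d) ≡ R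
    chosen*unchosen≡R d = trans (chosen*unchosen (choice d)) (trans (cong product (primesOf-choose d factors)) (sym R≡Πfactors))

    chosen-choice : ∀ {d} → d ∣ℕ R → chosen (choice d) ≡ d
    chosen-choice {d} d∣R = chosen-choose d factors (PrimeFactorisation.factorsPrime factorisation) (subst (d ∣ℕ_) R≡Πfactors d∣R)

    A : ℕ → Gaussian
    A d = root (choice d)

    norm-A : ∀ d → norm (A d) ≡ + R
    norm-A d = trans (norm-root (choice d) (choice-splits d))
                     (cong +_ (trans (cong product (primesOf-choose d factors)) (sym R≡Πfactors)))

    P : ℕ → Gaussian
    P d = A d · A d

    -- The invariant telling the points apart: P d · Γ² = U² · chosenSq², whose
    -- content is U² where U = R / d is the product of the unchosen primes.
    Γ² : Gaussian
    Γ² = Γ factors · Γ factors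

    content-PΓ² : ∀ d → content (P d · Γ²) ≡ unchosen (choice d) ℕ.* unchosen (choice d)
    content-PΓ² d = begin
      content (P d · Γ²)                                ≡⟨ cong content (·-interchange (A d) (A d) (Γ factors) (Γ factors)) ⟩
      content ((A d · Γ factors) · (A d · Γ factors))   ≡⟨ cong (λ X → content (X · X)) AΓ≡UY ⟩
      content (scale (+ U) Y · scale (+ U) Y)           ≡⟨ cong content (scale-·-scale (+ U) (+ U) Y Y) ⟩
      content (scale (+ U * + U) (Y · Y))               ≡⟨ cong (λ n → content (scale n (Y · Y))) (sym (ℤ.pos-* U U)) ⟩
      content (scale (+ (U ℕ.* U)) (Y · Y))             ≡⟨ content-scale (U ℕ.* U) (Y · Y) ⟩
      U ℕ.* U ℕ.* content (Y · Y)                       ≡⟨ cong (U ℕ.* U ℕ.*_) (chosenSq²-primitive (choice d) (choice-ok d)) ⟩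
      U ℕ.* U ℕ.* 1                                     ≡⟨ ℕ.*-identityʳ (U ℕ.* U) ⟩
      U ℕ.* U                                           ∎
      where
      open ≡-Reasoning
      U = unchosen (choice d)
      Y = chosenSq (choice d)
      AΓ≡UY : A d · Γ factors ≡ scale (+ U) Y
      AΓ≡UY = subst (λ qs → A d · Γ qs ≡ scale (+ U) Y) (primesOf-choose d factors)
                    (root-·-Γ (choice d) (choice-splits d))

    -- Divisors with equal or antipodal points coincide: the contents agree, so
    -- do the unchosen parts U, hence so do the chosen parts d = R / U.
    P-injective : ∀ {d d′} → d ∣ℕ R → d′ ∣ℕ R → P d ≡ P d′ ⊎ P d ≡ neg (P d′) → d ≡ d′
    P-injective {d} {d′} d∣R d′∣R P≡±P′ = trans (sym (chosen-choice d∣R)) (trans C≡C′ (chosen-choice d′∣R))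
      where
      sameContent : P d ≡ P d′ ⊎ P d ≡ neg (P d′) → content (P d · Γ²) ≡ content (P d′ · Γ²)
      sameContent (inj₁ P≡P′) = cong (λ X → content (X · Γ²)) P≡P′
      sameContent (inj₂ P≡-P′) = trans (cong (λ X → content (X · Γ²)) P≡-P′)
                               (trans (cong content (neg-· (P d′) Γ²)) (content-neg (P d′ · Γ²)))
      U≡U′ : unchosen (choice d) ≡ unchosen (choice d′)
      U≡U′ = m²≡n²⇒m≡n _ _ (trans (sym (content-PΓ² d)) (trans (sameContent P≡±P′) (content-PΓ² d′)))
      instance
        U-nonZero : ℕ.NonZero (unchosen (choice d))
        U-nonZero = ℕ.m*n≢0⇒n≢0 (chosen (choice d)) {{subst ℕ.NonZero (sym (chosen*unchosen≡R d)) R-nonZero}}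
      C≡C′ : chosen (choice d) ≡ chosen (choice d′)
      C≡C′ = ℕ.*-cancelʳ-≡ _ _ (unchosen (choice d))
               (trans (chosen*unchosen≡R d) (trans (sym (chosen*unchosen≡R d′)) (cong (chosen (choice d′) ℕ.*_) (sym U≡U′))))

    R²≢0 : + R * + R ≢ + 0
    R²≢0 R²≡0 = ℕ.≢-nonZero⁻¹ (R ℕ.* R) {{ℕ.m*n≢0 R R}} (ℤ.+-injective (trans (ℤ.pos-* R R) R²≡0))

    norm-P : ∀ d → norm (P d) ≡ + R * + R
    norm-P d = norm-SquarePoint (A d , norm-A d , inj₁ refl)

    -- a point of nonzero norm is not its own antipode
    P≢-P : ∀ d → P d ≢ neg (P d)
    P≢-P d P≡-P = R²≢0 (trans (sym (norm-P d))
      (cong₂ (λ s t → s * s + t * t) (selfNegative _ (cong proj₁ P≡-P)) (selfNegative _ (cong proj₂ P≡-P))))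
      where
      selfNegative : ∀ i → i ≡ - i → i ≡ + 0
      selfNegative (+ ℕ.zero) _ = refl
      selfNegative (+ suc n) ()
      selfNegative -[1+ n ] ()

    -- the divisors of R, listed exactly as in the definition of τ
    divisors : List ℕ
    divisors = filter (_∣? R) (map suc (upTo R))

    divisor-∣ : ∀ {d} → d ∈ divisors → d ∣ℕ R
    divisor-∣ d∈ = proj₂ (∈-filter⁻ (_∣? R) {xs = map suc (upTo R)} d∈)

    divisors-unique : Unique divisors
    divisors-unique = Unique.filter⁺ (_∣? R) (Unique.map⁺ ℕ.suc-injective (Unique.upTo⁺ R))

    divisor⁺ : ∀ {d} → d ℕ.< suc R → 0 ℕ.< d → d ∣ℕ R → d ∈ divisors
    divisor⁺ {suc d} (ℕ.s≤s d<R) _ d∣R = ∈-filter⁺ (_∣? R) (∈-map⁺ suc (∈-upTo⁺ d<R)) d∣R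

    points : List Gaussian
    points = withAntipodes P divisors

    length-points : length points ≡ 2 ℕ.* τ R
    length-points = length-withAntipodes P divisors

    point-SquarePoint : ∀ {X} → X ∈ points → SquarePoint (+ R) X
    point-SquarePoint X∈ with ∈-withAntipodes⁻ P divisors X∈
    ... | d , _ , X≡±P = A d , norm-A d , X≡±P

    onCircle : All (λ X → dist² X origin ≡ + R * + R) points
    onCircle = All.tabulate λ {X} X∈ → trans (dist²-to-origin X) (norm-SquarePoint (point-SquarePoint X∈))

    unique : Unique (origin ∷ points)
    unique = All.tabulate (λ X∈ origin≡X → R²≢0 (trans (sym (norm-SquarePoint (point-SquarePoint X∈))) (cong norm (sym origin≡X))))
           ∷ withAntipodes-unique P divisors divisors-unique P≢-P (λ d∈ d′∈ → P-injective (divisor-∣ d∈) (divisor-∣ d′∈))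

    integralDistances : ∀ {X Y} → X ∈ origin ∷ points → Y ∈ origin ∷ points → HasIntegerDistance X Y
    integralDistances (here refl) (here refl) = 0 , refl
    integralDistances (here refl) (there Y∈) = integral-from-origin (point-SquarePoint Y∈)
    integralDistances (there X∈) (here refl) = integral-to-origin (point-SquarePoint X∈)
    integralDistances (there X∈) (there Y∈) = integral-SquarePoints (point-SquarePoint X∈) (point-SquarePoint Y∈)

    -- The origin, P 1 and P R are not collinear: otherwise P R = ±P 1 and R = 1.
    notCollinear : NotAllCollinear (origin ∷ points)
    notCollinear = origin , P 1 , P R , here refl , there (∈-withAntipodes⁺ P divisors 1∈) ,
                   there (∈-withAntipodes⁺ P divisors R∈) , collinear⇒R≡1
      where
      0<R = ℕ.<-trans ℕ.z<s 1<R
      1∈ : 1 ∈ divisors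
      1∈ = divisor⁺ (ℕ.s≤s 0<R) ℕ.z<s (ℕ∣.1∣ R)
      R∈ : R ∈ divisors
      R∈ = divisor⁺ (ℕ.n<1+n R) 0<R ℕ∣.∣-refl
      collinear⇒R≡1 : Collinear origin (P 1) (P R) → ⊥
      collinear⇒R≡1 collinear = ℕ.<⇒≢ 1<R (sym (P-injective ℕ∣.∣-refl (ℕ∣.1∣ R)
        (collinear-with-origin (P 1) (P R) (+ R * + R) (norm-P 1) (norm-P R) R²≢0 collinear)))

open import Defs
open import Data.Nat using (ℕ; _<_; _*_; _%_)
open import Data.Nat.Divisibility using (_∣_)
open import Data.Nat.Primality using (Prime)
open import Data.Integer using (+_) renaming (_*_ to _*ℤ_)
open import Data.Product using (_×_; _,_; ∃-syntax)
open import Data.List using (length; _∷_)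
open import Data.List.Relation.Unary.All using (All)
open import Relation.Binary.PropositionalEquality using (_≡_)
open CircleGeometry using (origin)
open Construction using (module PointSet)

mainTheorem3 : (R : ℕ) → 1 < R →
    (∀ p → Prime p → p ∣ R → p % 4 ≡ 1) →
    ∃[ c ] ∃[ L ]
      (length L ≡ 2 * τ R ×
       All (λ P → dist² P c ≡ (+ R) *ℤ (+ R)) L ×
       IntegralPointSet (c ∷ L))
mainTheorem3 R 1<R oneModFour =
  origin , points , length-points , onCircle , unique , notCollinear , integralDistances
  where open PointSet R 1<R oneModFour
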